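{- Let $\mathcal{F}$ be a chromatic frame over $\Sigma$ and let $Z$ be a positive integer with $Z\ge 3mC-1$. If $\mathcal{F}$ has a $Z$-solution and $\mathcal{F}\models\phi^*$, then there exists a finite structure $\mathfrak{A}$ interpreting $\Sigma$ such that $\mathfrak{A}\models\phi^*$.
   Context: $\Sigma$ is a finite signature of unary and binary predicates (no constants, no function symbols; equality is a logical constant). Let $\alpha(x)$ be a quantifier-free, equality-free formula over $\Sigma$ with only variable $x$, $\beta(x,y)$ a quantifier-free, equality-free formula over $\Sigma$ with only variables $x,y$, $f_1,\dots,f_m$ binary predicates of $\Sigma$ ($m\ge1$), $C_1,\dots,C_m$ positive integers, $C=\max_h C_h$, and $\phi^* := \forall x\,\alpha\wedge\forall x\forall y(\beta\vee x\approx y)\wedge\bigwedge_{h=1}^m\forall x\,\exists_{=C_h}y\,(f_h(x,y)\wedge x\not\approx y)$. The counting predicates are $f_1,\dots,f_m$. A 1-type is a maximal consistent set of equality-free literals in the variable $x$ only; enumerate the 1-types as $\pi_1,\dots,\pi_L$. A 2-type is a maximal consistent set of equality-free literals in $x,y$; $\tau^{ -1}$ swaps $x,y$; $\mathrm{tp}_1(\tau)$ is the 1-type contained in $\tau$, $\mathrm{tp}_2(\tau)=\mathrm{tp}_1(\tau^{ -1})$. A 2-type $\tau$ is a message-type if $f_h(x,y)\in\tau$ for some $h$; invertible if $\tau,\tau^{ -1}$ are both message-types; silent if neither $\tau$ nor $\tau^{ -1}$ is a message-type; $\Xi$ is the set of silent 2-types. Enumerate the message-types as $\mu_1,\dots,\mu_M$,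 the invertible ones being exactly $\mu_1,\dots,\mu_{M^*}$. A star-type is a pair $\sigma=\langle\pi,\bar v\rangle$, $\pi$ a 1-type, $\bar v\in\mathbb N^M$, such that $v_j>0$ implies $\mathrm{tp}_1(\mu_j)=\pi$; write $\mathrm{tp}(\sigma)=\pi$, $\sigma[j]=v_j$. It is chromatic if for every 1-type $\pi'$ the sum $\sum\{v_j:1\le j\le M^*,\ \mathrm{tp}_2(\mu_j)=\pi'\}$ is $0$ or $1$, and is $0$ when $\pi'=\pi$. A frame is $\mathcal F=(\bar\sigma,I,\theta)$ where $\bar\sigma=(\sigma_1,\dots,\sigma_N)$ is a list of pairwise distinct star-types, $I\subseteq\{\{i,i'\}:1\le i\le i'\le L\}$, and $\theta:I\to\Xi$ with $\mathrm{tp}_1(\theta(\{i,i'\}))=\pi_i$ and $\mathrm{tp}_2(\theta(\{i,i'\}))=\pi_{i'}$ whenever $i\le i'$; it is chromatic if every $\sigma_k$ is chromatic. $\mathcal F\models\phi^*$ means: (1) for all $k$, $\models\bigwedge\mathrm{tp}(\sigma_k)\to\alpha$; (2) for all $k,j$ with $\sigma_k[j]>0$, $\models\bigwedge\mu_j\to\beta(x,y)\wedge\beta(y,x)$; (3) for all $\{i,i'\}\in I$, $\models\bigwedge\theta(\{i,i'\})\to\beta(x,y)\wedge\beta(y,x)$; (4) for all $k$ and $h$, $\sum\{\sigma_k[j]:1\le j\le M,\ f_h(x,y)\in\mu_j\}=C_h$. For $1\le i\le L$, $1\le j\le M$, $1\le k\le N$: $o_{ik}=1$ if $\mathrm{tp}(\sigma_k)=\pi_i$,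 else $0$; $p_{ik}=1$ if $\sigma_k[j]=0$ for all $j$ with $\mathrm{tp}_2(\mu_j)=\pi_i$, else $0$; $q_{jk}=\sigma_k[j]$; $r_{ik}=\sum\{\sigma_k[j]:M^*<j\le M,\ \mathrm{tp}_2(\mu_j)=\pi_i\}$; $s_{ik}=\sum\{\sigma_k[j]:1\le j\le M,\ \mathrm{tp}_2(\mu_j)=\pi_i\}$. For $\bar w=(w_1,\dots,w_N)$ of positive integers: $u_i=\sum_k o_{ik}w_k$, $v_j=\sum_k q_{jk}w_k$ ($1\le j\le M^*$), $x_{ii'}=\sum_k o_{ik}p_{i'k}w_k$. For a positive integer $Z$, $\bar w$ is a $Z$-solution of $\mathcal F$ if for all $i,i'\in\{1..L\}$, $j\in\{1..M^*\}$, $k\in\{1..N\}$: (C1) $v_j=v_{j'}$ where $\mu_{j'}=\mu_j^{ -1}$; (C2) $s_{ik}\le u_i$; (C3) $u_i\le1$ or $u_i>Z$; (C4) if $o_{ik}=1$ then $u_i>1$ or $r_{i'k}\le x_{i'i}$; (C5) if $\{i,i'\}\notin I$ then $u_i\le1$ or $u_{i'}\le1$; (C6) if $\{i,i'\}\notin I$ and $o_{ik}=1$ then $u_i>1$ or $r_{i'k}\ge x_{i'i}$. -}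

module Defs where

open import Data.Nat using (ℕ; zero; suc; _≟_; _+_; _*_; _∸_; _≤_; _<_; _⊔_; _≤ᵇ_; _<ᵇ_)
open import Data.Bool using (Bool; true; false; _∧_; _∨_; not; if_then_else_)
import Data.Bool as B
open import Data.Fin using (Fin; zero; suc; toℕ)
import Data.Fin as F
open import Data.Vec using (Vec; []; _∷_; lookup)
import Data.Vec.Properties as VP
open import Data.List using (List; []; _∷_; _++_; filterᵇ; length; concatMap)
import Data.List as L
open import Data.Maybe using (Maybe; just; nothing; is-just)
open import Data.Product using (_×_; _,_; proj₁; proj₂)
import Data.Product.Properties as PP
open import Data.Sum using (_⊎_)
open import Relation.Nullary using (¬_)
open import Relation.Nullary.Decidable using (⌊_⌋)
open import Relation.Binary.PropositionalEquality using (_≡_)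

∑ : ∀ n → (Fin n → ℕ) → ℕ
∑ zero    g = 0
∑ (suc n) g = g zero + ∑ n (λ k → g (suc k))

allFin : ∀ n → (Fin n → Bool) → Bool
allFin zero    g = true
allFin (suc n) g = g zero ∧ allFin n (λ k → g (suc k))

anyFin : ∀ n → (Fin n → Bool) → Bool
anyFin zero    g = false
anyFin (suc n) g = g zero ∨ anyFin n (λ k → g (suc k))

maxFin : ∀ n → (Fin n → ℕ) → ℕ
maxFin zero    g = 0
maxFin (suc n) g = g zero ⊔ maxFin n (λ k → g (suc k))

count : ∀ n → (Fin n → Bool) → ℕ
count n p = ∑ n (λ k → if p k then 1 else 0)

allVecs : ∀ n → List (Vec Bool n)
allVecs zero    = [] ∷ []
allVecs (suc n) = concatMap (λ v → (true ∷ v) ∷ (false ∷ v) ∷ []) (allVecs n)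

_==v_ : ∀ {n} → Vec Bool n → Vec Bool n → Bool
u ==v v = ⌊ VP.≡-dec B._≟_ u v ⌋

-- Quantifier-free, equality-free formulas over a signature with nU unary
-- and nB binary predicates, in the variables Fin n
-- (n = 1: variable x; n = 2: variables x = zero, y = suc zero).

data Fm (nU nB n : ℕ) : Set where
  un   : Fin nU → Fin n → Fm nU nB n
  bin  : Fin nB → Fin n → Fin n → Fm nU nB n
  ⊤f   : Fm nU nB n
  ⊥f   : Fm nU nB n
  ¬f_  : Fm nU nB n → Fm nU nB n
  _∧f_ : Fm nU nB n → Fm nU nB n → Fm nU nB n
  _∨f_ : Fm nU nB n → Fm nU nB n → Fm nU nB n

eval : ∀ {nU nB n} → (Fin nU → Fin n → Bool) → (Fin nB → Fin n → Fin n → Bool)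
       → Fm nU nB n → Bool
eval U R (un P v)    = U P v
eval U R (bin Q v w) = R Q v w
eval U R ⊤f          = true
eval U R ⊥f          = false
eval U R (¬f φ)      = not (eval U R φ)
eval U R (φ ∧f ψ)    = eval U R φ ∧ eval U R ψ
eval U R (φ ∨f ψ)    = eval U R φ ∨ eval U R ψ

record Structure (nU nB : ℕ) : Set where
  field
    size : ℕ
    U    : Fin nU → Fin (suc size) → Bool
    B    : Fin nB → Fin (suc size) → Fin (suc size) → Bool

module _ {nU nB : ℕ} (𝔄 : Structure nU nB) where
  open Structure 𝔄

  evalS : ∀ {n} → Fm nU nB n → (Fin n → Fin (suc size)) → Bool
  evalS φ ρ = eval (λ P v → U P (ρ v)) (λ Q v w → B Q (ρ v) (ρ w)) φ

  asg2 : Fin (suc size) → Fin (suc size) → Fin 2 → Fin (suc size)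
  asg2 a b zero       = a
  asg2 a b (suc zero) = b

  -- 𝔄 ⊨ φ* = ∀x α ∧ ∀x∀y (β ∨ x≈y) ∧ ⋀_h ∀x ∃_{=C_h} y (f_h(x,y) ∧ x≉y)
  ModelsPhi* : (α : Fm nU nB 1) (β : Fm nU nB 2)
               (m : ℕ) (f : Fin m → Fin nB) (C : Fin m → ℕ) → Set
  ModelsPhi* α β m f C =
    (∀ a → evalS α (λ _ → a) ≡ true)
    × (∀ a b → evalS β (asg2 a b) ≡ true ⊎ a ≡ b)
    × (∀ h a → count (suc size) (λ b → B (f h) a b ∧ not ⌊ a F.≟ b ⌋) ≡ C h)

-- With no equality, every assignment of truth
-- values to the atoms is consistent, so a 1-type is exactly a truth
-- assignment to the atoms P(x), R(x,x), and a 2-type a truth assignment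
-- to P(x), P(y), R(x,x), R(x,y), R(y,x), R(y,y).

OneType : ℕ → ℕ → Set
OneType nU nB = Vec Bool nU × Vec Bool nB

record TwoType (nU nB : ℕ) : Set where
  constructor mk2
  field
    ux uy           : Vec Bool nU
    bxx bxy byx byy : Vec Bool nB

module Types (nU nB : ℕ) where
  open TwoType

  _==1_ : OneType nU nB → OneType nU nB → Bool
  (u , b) ==1 (u' , b') = (u ==v u') ∧ (b ==v b')

  tp1 : TwoType nU nB → OneType nU nB
  tp1 τ = ux τ , bxx τ

  tp2 : TwoType nU nB → OneType nU nB
  tp2 τ = uy τ , byy τ

  inv : TwoType nU nB → TwoType nU nB
  inv τ = mk2 (uy τ) (ux τ) (byy τ) (byx τ) (bxy τ) (bxx τ)

  all1 : List (OneType nU nB)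
  all1 = concatMap (λ u → L.map (λ b → u , b) (allVecs nB)) (allVecs nU)

  Lₜ : ℕ
  Lₜ = length all1

  π : Fin Lₜ → OneType nU nB
  π = L.lookup all1

  all2 : List (TwoType nU nB)
  all2 = concatMap (λ a → concatMap (λ b → concatMap (λ c → concatMap (λ d →
           concatMap (λ e → L.map (λ g → mk2 a b c d e g) (allVecs nB))
             (allVecs nB)) (allVecs nB)) (allVecs nB)) (allVecs nU)) (allVecs nU)

  eval1 : Fm nU nB 1 → OneType nU nB → Bool
  eval1 φ (u , b) = eval (λ P _ → lookup u P) (λ Q _ _ → lookup b Q) φ

  eval2 : Fm nU nB 2 → TwoType nU nB → Bool
  eval2 φ τ = eval U R φ
    where
    U : Fin nU → Fin 2 → Bool
    U P zero       = lookup (ux τ) P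
    U P (suc zero) = lookup (uy τ) P
    R : Fin nB → Fin 2 → Fin 2 → Bool
    R Q zero       zero       = lookup (bxx τ) Q
    R Q zero       (suc zero) = lookup (bxy τ) Q
    R Q (suc zero) zero       = lookup (byx τ) Q
    R Q (suc zero) (suc zero) = lookup (byy τ) Q

module Ctx (nU nB m : ℕ) (f : Fin m → Fin nB) where
  open Types nU nB public
  open TwoType

  isMsg : TwoType nU nB → Bool
  isMsg τ = anyFin m (λ h → lookup (bxy τ) (f h))

  invertible : TwoType nU nB → Bool
  invertible τ = isMsg τ ∧ isMsg (inv τ)

  silent : TwoType nU nB → Bool
  silent τ = not (isMsg τ) ∧ not (isMsg (inv τ))

  invMsgs : List (TwoType nU nB)
  invMsgs = filterᵇ invertible all2

  allMsgs : List (TwoType nU nB)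
  allMsgs = invMsgs ++ filterᵇ (λ τ → isMsg τ ∧ not (invertible τ)) all2

  M : ℕ
  M = length allMsgs

  M* : ℕ
  M* = length invMsgs

  μ : Fin M → TwoType nU nB
  μ = L.lookup allMsgs

  RawStar : Set
  RawStar = OneType nU nB × Vec ℕ M

  IsStar : RawStar → Set
  IsStar (p , v) = ∀ j → 0 < lookup v j → tp1 (μ j) ≡ p

  Chromatic : RawStar → Set
  Chromatic (p , v) = ∀ (p' : OneType nU nB) →
      (S p' ≤ 1) × (p' ≡ p → S p' ≡ 0)
    where
    S : OneType nU nB → ℕ
    S p' = ∑ M (λ j → if (toℕ j <ᵇ M*) ∧ (tp2 (μ j) ==1 p') then lookup v j else 0)

  -- The pair (I, θ) is encoded by θ : Fin L → Fin L → Maybe 2-type: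
  -- for i ≤ i', {i,i'} ∈ I iff θ i i' = just τ, and then θ({i,i'}) = τ.
  -- Values θ i i' with i > i' are never consulted.
  record Frame : Set where
    field
      N        : ℕ
      σ        : Fin N → RawStar
      star     : ∀ k → IsStar (σ k)
      distinct : ∀ k k' → σ k ≡ σ k' → k ≡ k'
      θ        : Fin Lₜ → Fin Lₜ → Maybe (TwoType nU nB)
      θ-ok     : ∀ i i' τ → toℕ i ≤ toℕ i' → θ i i' ≡ just τ →
                 (silent τ ≡ true) × (tp1 τ ≡ π i) × (tp2 τ ≡ π i')

  module _ (𝓕 : Frame) where
    open Frame 𝓕

    IsChromatic : Set
    IsChromatic = ∀ k → Chromatic (σ k)

    tpσ : Fin N → OneType nU nB
    tpσ k = proj₁ (σ k)

    _[_] : Fin N → Fin M → ℕ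
    k [ j ] = lookup (proj₂ (σ k)) j

    inI : Fin Lₜ → Fin Lₜ → Bool
    inI i i' = if toℕ i ≤ᵇ toℕ i' then is-just (θ i i') else is-just (θ i' i)

    FrameModels : Fm nU nB 1 → Fm nU nB 2 → (Fin m → ℕ) → Set
    FrameModels α β C =
        (∀ k → eval1 α (tpσ k) ≡ true)
      × (∀ k j → 0 < k [ j ] → (eval2 β (μ j) ≡ true) × (eval2 β (inv (μ j)) ≡ true))
      × (∀ i i' τ → toℕ i ≤ toℕ i' → θ i i' ≡ just τ →
           (eval2 β τ ≡ true) × (eval2 β (inv τ) ≡ true))
      × (∀ k h → ∑ M (λ j → if lookup (bxy (μ j)) (f h) then k [ j ] else 0) ≡ C h)

    o : Fin Lₜ → Fin N → ℕ
    o i k = if tpσ k ==1 π i then 1 else 0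

    p : Fin Lₜ → Fin N → ℕ
    p i k = if allFin M (λ j → if tp2 (μ j) ==1 π i then ⌊ k [ j ] ≟ 0 ⌋ else true)
            then 1 else 0

    q : Fin M → Fin N → ℕ
    q j k = k [ j ]

    r : Fin Lₜ → Fin N → ℕ
    r i k = ∑ M (λ j → if (M* <ᵇ suc (toℕ j)) ∧ (tp2 (μ j) ==1 π i) then k [ j ] else 0)

    s : Fin Lₜ → Fin N → ℕ
    s i k = ∑ M (λ j → if tp2 (μ j) ==1 π i then k [ j ] else 0)

    module _ (w : Fin N → ℕ) where
      uₛ : Fin Lₜ → ℕ
      uₛ i = ∑ N (λ k → o i k * w k)

      vₛ : Fin M → ℕ
      vₛ j = ∑ N (λ k → q j k * w k)

      xₛ : Fin Lₜ → Fin Lₜ → ℕ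
      xₛ i i' = ∑ N (λ k → o i k * p i' k * w k)

    IsSolution : ℕ → (Fin N → ℕ) → Set
    IsSolution Z w =
        (∀ k → 1 ≤ w k)
      × (∀ j j' → toℕ j < M* → μ j' ≡ inv (μ j) → vₛ w j ≡ vₛ w j')            -- C1
      × (∀ i k → s i k ≤ uₛ w i)                                                -- C2
      × (∀ i → uₛ w i ≤ 1 ⊎ Z < uₛ w i)                                         -- C3
      × (∀ i i' k → o i k ≡ 1 → 1 < uₛ w i ⊎ r i' k ≤ xₛ w i' i)                -- C4
      × (∀ i i' → inI i i' ≡ false → uₛ w i ≤ 1 ⊎ uₛ w i' ≤ 1)                  -- C5
      × (∀ i i' k → inI i i' ≡ false → o i k ≡ 1 → 1 < uₛ w i ⊎ xₛ w i' i ≤ r i' k) -- C6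

-- Take w k copies of each star-type σ_k.  (C3) and Z ≥ 3mC − 1 make every 1-type either royal
-- (realised at most once) or realised at least 3D times, where D = m · max C bounds the number of
-- messages an element sends.  An invertible message type μ_j is realised by matching the i-th
-- element that must send μ_j with the i-th element that must send μ_j⁻¹: chromaticity makes these
-- demands 0 or 1, and (C1) makes both groups equally large.  The one-way messages of an element a
-- go, in disjoint windows of ranks, to candidates of the required 1-type t: if a is royal, to the
-- elements of type t not messaging a's type, which suffice by (C4); if t is royal, to all elements
-- of type t, which suffice by (C2); otherwise to the elements of type t in the block of D positions
-- following a's own block, which excludes messages in both directions.  Pairs exchanging no
-- message receive the silent 2-type θ, which exists by (C5) and (C6).

module Submission where

open import Defs
open import Data.Nat using (ℕ; zero; suc; _+_; _*_; _∸_; _≤_; _<_; _⊓_; _≤ᵇ_; _<ᵇ_; _≟_; _<?_; z≤n; s≤s)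
open import Data.Nat.Properties
open import Algebra.Properties.CommutativeSemigroup +-commutativeSemigroup using (interchange)
open import Data.Bool using (Bool; true; false; _∧_; _∨_; not; if_then_else_; T)
open import Data.Bool.Properties using (T-≡; ∧-zeroʳ; ∧-identityʳ; ∧-comm; ∧-assoc; ∨-zeroʳ; ∨-identityʳ)
import Data.Bool as B
open import Data.Fin using (Fin; zero; suc; toℕ; _↑ˡ_; _↑ʳ_; splitAt)
import Data.Fin as F
import Data.Fin.Properties as FP
open import Data.Product using (_×_; _,_; proj₁; proj₂; Σ)
open import Data.Sum using (_⊎_; inj₁; inj₂; [_,_]′)
open import Data.Empty using (⊥; ⊥-elim)
open import Data.Maybe using (Maybe; just; nothing; is-just; fromMaybe)
import Data.Maybe
open import Data.Vec using (Vec; []; _∷_; lookup)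
import Data.Vec as V
import Data.Vec.Properties as VP
open import Data.List using (List; []; _∷_; _++_; concatMap; length; filterᵇ)
import Data.List as L
open import Data.List.Membership.Propositional using (_∈_; lose)
open import Data.List.Membership.Propositional.Properties using (∈-concatMap⁺; ∈-lookup; ∈-filter⁺; ∈-map⁺; ∈-++⁺ˡ)
open import Data.List.Relation.Unary.Any using (here; there; index)
open import Data.List.Relation.Unary.Any.Properties using (lookup-index)
open import Data.List.Relation.Unary.All as All using (All; []; _∷_)
import Data.List.Relation.Unary.All.Properties as AllP
open import Data.List.Relation.Unary.AllPairs as AllPairs using ([]; _∷_)
import Data.List.Relation.Unary.AllPairs.Properties as AllPairsP
open import Data.List.Relation.Unary.Unique.Propositional using (Unique)
import Data.List.Relation.Unary.Unique.Propositional.Properties as UP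
open import Data.List.Relation.Binary.Disjoint.Propositional using (Disjoint)
open import Function using (_∘_; id)
open import Function.Bundles using (Equivalence)
open import Relation.Nullary using (¬_; yes; no)
open import Relation.Nullary.Decidable using (⌊_⌋; T?; toSum)
open import Relation.Binary.PropositionalEquality
open import Relation.Binary.Definitions using (Tri; tri<; tri≈; tri>)

𝟙 : Bool → ℕ
𝟙 b = if b then 1 else 0

false≢true : false ≢ true
false≢true ()

true⇒T : ∀ {b} → b ≡ true → T b
true⇒T = Equivalence.from T-≡

<ᵇ⇒<′ : ∀ {m n} → (m <ᵇ n) ≡ true → m < n
<ᵇ⇒<′ {m} {n} = <ᵇ⇒< m n ∘ true⇒T

<⇒<ᵇ′ : ∀ {m n} → m < n → (m <ᵇ n) ≡ true
<⇒<ᵇ′ = Equivalence.to T-≡ ∘ <⇒<ᵇ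

≤ᵇ⇒≤′ : ∀ {m n} → (m ≤ᵇ n) ≡ true → m ≤ n
≤ᵇ⇒≤′ {m} {n} = ≤ᵇ⇒≤ m n ∘ true⇒T

≤⇒≤ᵇ′ : ∀ {m n} → m ≤ n → (m ≤ᵇ n) ≡ true
≤⇒≤ᵇ′ = Equivalence.to T-≡ ∘ ≤⇒≤ᵇ

≮⇒<ᵇ≡false : ∀ {m n} → ¬ m < n → (m <ᵇ n) ≡ false
≮⇒<ᵇ≡false {m} {n} m≮n with m <ᵇ n in e
... | true  = ⊥-elim (m≮n (<ᵇ⇒<′ e))
... | false = refl

≰⇒≤ᵇ≡false : ∀ {m n} → ¬ m ≤ n → (m ≤ᵇ n) ≡ false
≰⇒≤ᵇ≡false {m} {n} m≰n with m ≤ᵇ n in e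
... | true  = ⊥-elim (m≰n (≤ᵇ⇒≤′ e))
... | false = refl

≤ᵇ≡false⇒> : ∀ {m n} → (m ≤ᵇ n) ≡ false → n < m
≤ᵇ≡false⇒> e = ≰⇒> (λ m≤n → false≢true (trans (sym e) (≤⇒≤ᵇ′ m≤n)))

<ᵇ≡false⇒≥ : ∀ {m n} → (m <ᵇ n) ≡ false → n ≤ m
<ᵇ≡false⇒≥ e = ≮⇒≥ (λ m<n → false≢true (trans (sym e) (<⇒<ᵇ′ m<n)))

bool-cases : ∀ {A : Set} b → (b ≡ true → A) → (b ≡ false → A) → A
bool-cases true  t _ = t refl
bool-cases false _ f = f refl

if-true : ∀ {A : Set} {c} {x y : A} → c ≡ true → (if c then x else y) ≡ x
if-true refl = refl

if-0 : ∀ c → (if c then 0 else 0) ≡ 0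
if-0 true  = refl
if-0 false = refl

if-false : ∀ {A : Set} {c} {x y : A} → c ≡ false → (if c then x else y) ≡ y
if-false refl = refl

if-split : ∀ b c x → (if c then x else 0) ≡ (if b ∧ c then x else 0) + (if not b ∧ c then x else 0)
if-split true  true  x = sym (+-identityʳ x)
if-split false true  x = refl
if-split true  false x = refl
if-split false false x = refl

if≤ : ∀ c x → (if c then x else 0) ≤ x
if≤ true  x = ≤-refl
if≤ false x = z≤n

if-zero : ∀ c x → (c ≡ true → x ≡ 0) → (if c then x else 0) ≡ 0
if-zero true  x x≡0 = x≡0 refl
if-zero false x _   = refl

if-if : ∀ e c (x : ℕ) → (if e then (if c then x else 0) else 0) ≡ (if c ∧ e then x else 0)
if-if true  true  x = refl
if-if true  false x = refl
if-if false true  x = refl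
if-if false false x = refl

𝟙-∧ : ∀ x y → 𝟙 (x ∧ y) ≡ 𝟙 x * 𝟙 y
𝟙-∧ true  true  = refl
𝟙-∧ true  false = refl
𝟙-∧ false _     = refl

∧-true-left : ∀ x {y} → (x ∧ y) ≡ true → x ≡ true
∧-true-left true _ = refl

∧-true-right : ∀ x {y} → (x ∧ y) ≡ true → y ≡ true
∧-true-right true e = e

∧-true-intro : ∀ {x y} → x ≡ true → y ≡ true → (x ∧ y) ≡ true
∧-true-intro refl refl = refl

∨-true : ∀ x {y} → (x ∨ y) ≡ true → x ≡ true ⊎ y ≡ true
∨-true true  _ = inj₁ refl
∨-true false e = inj₂ e

not-true : ∀ {x} → not x ≡ true → x ≡ false
not-true {false} _ = refl

⌊≟⌋⇒≡ : ∀ {x y : ℕ} → ⌊ x ≟ y ⌋ ≡ true → x ≡ y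
⌊≟⌋⇒≡ {x} {y} e with x ≟ y
... | yes x≡y = x≡y

⌊≟⌋-refl : ∀ {k} (i : Fin k) → ⌊ i F.≟ i ⌋ ≡ true
⌊≟⌋-refl i with i F.≟ i
... | yes _   = refl
... | no  i≢i = ⊥-elim (i≢i refl)

≢⇒⌊≟⌋≡false : ∀ {k} {i j : Fin k} → i ≢ j → ⌊ i F.≟ j ⌋ ≡ false
≢⇒⌊≟⌋≡false {i = i} {j} i≢j with i F.≟ j
... | yes i≡j = ⊥-elim (i≢j i≡j)
... | no _    = refl

⌊≟⌋-sym : ∀ (x y : ℕ) → ⌊ x ≟ y ⌋ ≡ ⌊ y ≟ x ⌋
⌊≟⌋-sym x y with x ≟ y | y ≟ x
... | yes _   | yes _   = refl
... | no  _   | no  _   = refl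
... | yes x≡y | no  y≢x = ⊥-elim (y≢x (sym x≡y))
... | no  x≢y | yes y≡x = ⊥-elim (x≢y (sym y≡x))

∑-cong : ∀ n {g h : Fin n → ℕ} → (∀ k → g k ≡ h k) → ∑ n g ≡ ∑ n h
∑-cong zero    e = refl
∑-cong (suc n) e = cong₂ _+_ (e zero) (∑-cong n (e ∘ suc))

∑-distrib-+ : ∀ n (g h : Fin n → ℕ) → ∑ n (λ k → g k + h k) ≡ ∑ n g + ∑ n h
∑-distrib-+ zero    g h = refl
∑-distrib-+ (suc n) g h rewrite ∑-distrib-+ n (g ∘ suc) (h ∘ suc) = interchange (g zero) (h zero) _ _

∑-mono-≤ : ∀ n {g h : Fin n → ℕ} → (∀ k → g k ≤ h k) → ∑ n g ≤ ∑ n h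
∑-mono-≤ zero    e = z≤n
∑-mono-≤ (suc n) e = +-mono-≤ (e zero) (∑-mono-≤ n (e ∘ suc))

∑-zero : ∀ n {g : Fin n → ℕ} → (∀ k → g k ≡ 0) → ∑ n g ≡ 0
∑-zero zero    e = refl
∑-zero (suc n) e rewrite e zero = ∑-zero n (e ∘ suc)

∑-const : ∀ n c → ∑ n (λ _ → c) ≡ n * c
∑-const zero    c = refl
∑-const (suc n) c = cong (c +_) (∑-const n c)

∑-comm : ∀ n m (g : Fin n → Fin m → ℕ) → ∑ n (λ a → ∑ m (g a)) ≡ ∑ m (λ b → ∑ n (λ a → g a b))
∑-comm zero    m g = sym (∑-zero m (λ _ → refl))
∑-comm (suc n) m g = begin
  ∑ m (g zero) + ∑ n (λ a → ∑ m (g (suc a)))           ≡⟨ cong (∑ m (g zero) +_) (∑-comm n m (g ∘ suc)) ⟩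
  ∑ m (g zero) + ∑ m (λ b → ∑ n (λ a → g (suc a) b))   ≡⟨ sym (∑-distrib-+ m (g zero) _) ⟩
  ∑ m (λ b → ∑ (suc n) (λ a → g a b))                  ∎
  where open ≡-Reasoning

term≤∑ : ∀ n (g : Fin n → ℕ) a → g a ≤ ∑ n g
term≤∑ (suc n) g zero    = m≤m+n _ _
term≤∑ (suc n) g (suc a) = ≤-trans (term≤∑ n (g ∘ suc) a) (m≤n+m _ _)

two-terms≤∑ : ∀ n (g : Fin n → ℕ) a b → a ≢ b → g a + g b ≤ ∑ n g
two-terms≤∑ (suc n) g zero    zero    a≢b = ⊥-elim (a≢b refl)
two-terms≤∑ (suc n) g zero    (suc b) a≢b = +-monoʳ-≤ (g zero) (term≤∑ n _ b)
two-terms≤∑ (suc n) g (suc a) zero    a≢b =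
  subst (_≤ ∑ (suc n) g) (+-comm (g zero) (g (suc a))) (+-monoʳ-≤ (g zero) (term≤∑ n _ a))
two-terms≤∑ (suc n) g (suc a) (suc b) a≢b =
  ≤-trans (two-terms≤∑ n (g ∘ suc) a b (a≢b ∘ cong suc)) (m≤n+m _ _)

∑-single : ∀ n (a : Fin n) c → ∑ n (λ k → if ⌊ a F.≟ k ⌋ then c else 0) ≡ c
∑-single (suc n) zero    c = trans (cong (c +_) (∑-zero n (λ _ → refl))) (+-identityʳ c)
∑-single (suc n) (suc a) c = trans (∑-cong n shift) (∑-single n a c)
  where
  shift : ∀ k → (if ⌊ suc a F.≟ suc k ⌋ then c else 0) ≡ (if ⌊ a F.≟ k ⌋ then c else 0)
  shift k with a F.≟ k
  ... | yes _ = refl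
  ... | no _  = refl

∑-splitAt : ∀ a b (g : Fin (a + b) → ℕ) → ∑ (a + b) g ≡ ∑ a (λ x → g (x ↑ˡ b)) + ∑ b (λ y → g (a ↑ʳ y))
∑-splitAt zero    b g = refl
∑-splitAt (suc a) b g = trans (cong (g zero +_) (∑-splitAt a b (g ∘ suc))) (sym (+-assoc (g zero) _ _))

∑-pos⇒term-pos : ∀ n (g : Fin n → ℕ) → 0 < ∑ n g → Σ (Fin n) (λ k → 0 < g k)
∑-pos⇒term-pos (suc n) g p with g zero in eq
... | suc _ = zero , subst (0 <_) (sym eq) (s≤s z≤n)
... | zero  = let k , q = ∑-pos⇒term-pos n (g ∘ suc) p in suc k , q

∑≤n*maxFin : ∀ n (g : Fin n → ℕ) → ∑ n g ≤ n * maxFin n g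
∑≤n*maxFin zero    g = z≤n
∑≤n*maxFin (suc n) g = +-mono-≤ (m≤m⊔n (g zero) _)
  (≤-trans (∑≤n*maxFin n (g ∘ suc)) (*-monoʳ-≤ n (m≤n⊔m (g zero) _)))

∑-prefix+term≤∑ : ∀ k (c : Fin k → Bool) (g : Fin k → ℕ) j →
                  ∑ k (λ x → if (toℕ x <ᵇ toℕ j) ∧ c x then g x else 0) + (if c j then g j else 0)
                  ≤ ∑ k (λ x → if c x then g x else 0)
∑-prefix+term≤∑ (suc k) c g zero    =
  subst (λ z → z + (if c zero then g zero else 0) ≤ ∑ (suc k) (λ x → if c x then g x else 0)) (sym nothing-before)
        (term≤∑ (suc k) (λ x → if c x then g x else 0) zero)
  where
  nothing-before : ∑ k (λ x → if (toℕ (suc x) <ᵇ 0) ∧ c (suc x) then g (suc x) else 0) ≡ 0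
  nothing-before = ∑-zero k (λ _ → refl)
∑-prefix+term≤∑ (suc k) c g (suc j) =
  ≤-trans (≤-reflexive (+-assoc (if c zero then g zero else 0) _ _))
          (+-monoʳ-≤ (if c zero then g zero else 0) (∑-prefix+term≤∑ k (c ∘ suc) (g ∘ suc) j))

count-cong : ∀ n {p q : Fin n → Bool} → (∀ k → p k ≡ q k) → count n p ≡ count n q
count-cong n e = ∑-cong n (cong 𝟙 ∘ e)

count-split : ∀ n (p q : Fin n → Bool) →
              count n p ≡ count n (λ k → p k ∧ q k) + count n (λ k → p k ∧ not (q k))
count-split n p q = trans (∑-cong n split) (∑-distrib-+ n _ _)
  where
  split : ∀ k → 𝟙 (p k) ≡ 𝟙 (p k ∧ q k) + 𝟙 (p k ∧ not (q k))
  split k with p k | q k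
  ... | true  | true  = refl
  ... | true  | false = refl
  ... | false | _     = refl

count-mono : ∀ n {p q : Fin n → Bool} → (∀ k → p k ≡ true → q k ≡ true) → count n p ≤ count n q
count-mono n {p} {q} p⇒q = ∑-mono-≤ n pointwise
  where
  pointwise : ∀ k → 𝟙 (p k) ≤ 𝟙 (q k)
  pointwise k with p k in pk
  ... | false = z≤n
  ... | true rewrite p⇒q k pk = ≤-refl

count-zero : ∀ n {p : Fin n → Bool} → (∀ k → p k ≡ false) → count n p ≡ 0
count-zero n e = ∑-zero n (cong 𝟙 ∘ e)

count-pos⇒witness : ∀ n (p : Fin n → Bool) → 0 < count n p → Σ (Fin n) (λ k → p k ≡ true)
count-pos⇒witness n p pos with ∑-pos⇒term-pos n _ pos
... | k , q with p k in pk
... | true = k , pk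

witness⇒count-pos : ∀ n (p : Fin n → Bool) a → p a ≡ true → 1 ≤ count n p
witness⇒count-pos n p a pa = ≤-trans (≤-reflexive (cong 𝟙 (sym pa))) (term≤∑ n _ a)

two-witnesses⇒count≥2 : ∀ n (p : Fin n → Bool) a b → a ≢ b → p a ≡ true → p b ≡ true → 2 ≤ count n p
two-witnesses⇒count≥2 n p a b a≢b pa pb =
  ≤-trans (≤-reflexive (cong₂ _+_ (cong 𝟙 (sym pa)) (cong 𝟙 (sym pb)))) (two-terms≤∑ n _ a b a≢b)

count-∧-const : ∀ n (p : Fin n → Bool) e → count n (λ k → p k ∧ e) ≡ (if e then count n p else 0)
count-∧-const n p true  = count-cong n (λ k → ∧-identityʳ (p k))
count-∧-const n p false = count-zero n (λ k → ∧-zeroʳ (p k))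

count-<-superset : ∀ n {p q : Fin n → Bool} b → (∀ k → p k ≡ true → q k ≡ true) → q b ≡ true → p b ≡ false →
                   count n p < count n q
count-<-superset n {p} {q} b p⇒q qb ¬pb = begin-strict
  count n p                                                         ≡⟨ count-cong n inside ⟨
  count n (λ k → q k ∧ p k)                                         <⟨ m<m+n _ (witness⇒count-pos n _ b (∧-true-intro qb (cong not ¬pb))) ⟩
  count n (λ k → q k ∧ p k) + count n (λ k → q k ∧ not (p k))       ≡⟨ count-split n q p ⟨
  count n q                                                         ∎
  where
  open ≤-Reasoning
  inside : ∀ k → (q k ∧ p k) ≡ p k
  inside k with p k in pk
  ... | true  = trans (∧-identityʳ (q k)) (p⇒q k pk)
  ... | false = ∧-zeroʳ (q k)

count-remove : ∀ n (p : Fin n → Bool) a → count n (λ k → p k ∧ not ⌊ a F.≟ k ⌋) + 𝟙 (p a) ≡ count n p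
count-remove n p a = begin
  count n (λ k → p k ∧ not ⌊ a F.≟ k ⌋) + 𝟙 (p a)                          ≡⟨ +-comm _ (𝟙 (p a)) ⟩
  𝟙 (p a) + count n (λ k → p k ∧ not ⌊ a F.≟ k ⌋)                          ≡⟨ cong (_+ count n (λ k → p k ∧ not ⌊ a F.≟ k ⌋)) at-a ⟩
  count n (λ k → p k ∧ ⌊ a F.≟ k ⌋) + count n (λ k → p k ∧ not ⌊ a F.≟ k ⌋) ≡⟨ sym (count-split n p _) ⟩
  count n p                                                                ∎
  where
  open ≡-Reasoning
  pointwise : ∀ k → 𝟙 (p k ∧ ⌊ a F.≟ k ⌋) ≡ (if ⌊ a F.≟ k ⌋ then 𝟙 (p a) else 0)
  pointwise k with a F.≟ k
  ... | yes refl = cong 𝟙 (∧-identityʳ (p a))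
  ... | no _     = cong 𝟙 (∧-zeroʳ (p k))
  at-a : 𝟙 (p a) ≡ count n (λ k → p k ∧ ⌊ a F.≟ k ⌋)
  at-a = sym (trans (∑-cong n pointwise) (∑-single n a (𝟙 (p a))))

rank : ∀ n → (Fin n → Bool) → Fin n → ℕ
rank n P b = count n (λ c → (toℕ c <ᵇ toℕ b) ∧ P c)

rank-zero : ∀ n P → rank (suc n) P zero ≡ 0
rank-zero n P = count-zero n (λ _ → refl)

count-rank< : ∀ n P x → count n (λ b → P b ∧ (rank n P b <ᵇ x)) ≡ x ⊓ count n P
count-rank< zero    P x = sym (⊓-zeroʳ x)
count-rank< (suc n) P x rewrite rank-zero n P with P zero
count-rank< (suc n) P zero    | true  = count-zero n (λ _ → ∧-zeroʳ _)
count-rank< (suc n) P (suc x) | true  = cong suc (count-rank< n (P ∘ suc) x)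
count-rank< (suc n) P x       | false = count-rank< n (P ∘ suc) x

rank<count : ∀ n P a → P a ≡ true → rank n P a < count n P
rank<count (suc n) P zero    Pa rewrite rank-zero n P = witness⇒count-pos (suc n) P zero Pa
rank<count (suc n) P (suc a) Pa = +-monoʳ-< (𝟙 (P zero)) (rank<count n (P ∘ suc) a Pa)

inWindow : ℕ → ℕ → ℕ → Bool
inWindow lo len x = not (x <ᵇ lo) ∧ (x <ᵇ lo + len)

inWindow⇒bounds : ∀ lo len {x} → inWindow lo len x ≡ true → lo ≤ x × x < lo + len
inWindow⇒bounds lo len {x} e with x <ᵇ lo in below | x <ᵇ lo + len in above
... | false | true = <ᵇ≡false⇒≥ below , <ᵇ⇒<′ above

count-rank-window : ∀ n P lo len → lo + len ≤ count n P →
                    count n (λ b → P b ∧ inWindow lo len (rank n P b)) ≡ len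
count-rank-window n P lo len fits = +-cancelˡ-≡ lo _ _ (begin
  lo + W                                                                  ≡⟨ cong (_+ W) (sym below-lo) ⟩
  count n (λ b → P b ∧ (rk b <ᵇ lo)) + W                                  ≡⟨ cong₂ _+_ (count-cong n below) (count-cong n window) ⟨
  count n (λ b → (P b ∧ (rk b <ᵇ hi)) ∧ (rk b <ᵇ lo))
    + count n (λ b → (P b ∧ (rk b <ᵇ hi)) ∧ not (rk b <ᵇ lo))             ≡⟨ count-split n _ (λ b → rk b <ᵇ lo) ⟨
  count n (λ b → P b ∧ (rk b <ᵇ hi))                                      ≡⟨ count-rank< n P hi ⟩
  hi ⊓ count n P                                                          ≡⟨ m≤n⇒m⊓n≡m fits ⟩
  lo + len                                                                ∎)
  where
  open ≡-Reasoning
  hi : ℕ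
  hi = lo + len
  rk : Fin n → ℕ
  rk = rank n P
  W : ℕ
  W = count n (λ b → P b ∧ inWindow lo len (rk b))
  below-lo : count n (λ b → P b ∧ (rk b <ᵇ lo)) ≡ lo
  below-lo = trans (count-rank< n P lo) (m≤n⇒m⊓n≡m (≤-trans (m≤m+n lo len) fits))
  below : ∀ b → ((P b ∧ (rk b <ᵇ hi)) ∧ (rk b <ᵇ lo)) ≡ (P b ∧ (rk b <ᵇ lo))
  below b with rk b <ᵇ lo in r<lo
  ... | false = trans (∧-zeroʳ _) (sym (∧-zeroʳ (P b)))
  ... | true rewrite <⇒<ᵇ′ (≤-trans (<ᵇ⇒<′ r<lo) (m≤m+n lo len)) = ∧-identityʳ _
  window : ∀ b → ((P b ∧ (rk b <ᵇ hi)) ∧ not (rk b <ᵇ lo)) ≡ (P b ∧ inWindow lo len (rk b))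
  window b with rk b <ᵇ lo
  ... | false = ∧-identityʳ _
  ... | true  = trans (∧-zeroʳ _) (sym (∧-zeroʳ (P b)))

inWindow-1 : ∀ r x → inWindow r 1 x ≡ ⌊ x ≟ r ⌋
inWindow-1 r x with x ≟ r
... | yes refl = cong₂ (λ u v → not u ∧ v) (≮⇒<ᵇ≡false (n≮n x)) (<⇒<ᵇ′ (m<m+n x (s≤s z≤n)))
... | no x≢r with inWindow r 1 x in e
... | false = refl
... | true  = let r≤x , x<r+1 = inWindow⇒bounds r 1 e in
              ⊥-elim (x≢r (≤-antisym (m<1+n⇒m≤n (subst (x <_) (+-comm r 1) x<r+1)) r≤x))

count-rank≡ : ∀ n P r → r < count n P → count n (λ b → P b ∧ ⌊ rank n P b ≟ r ⌋) ≡ 1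
count-rank≡ n P r r<c =
  trans (count-cong n (λ b → cong (P b ∧_) (sym (inWindow-1 r (rank n P b)))))
        (count-rank-window n P r 1 (≤-trans (≤-reflexive (+-comm r 1)) r<c))

anyFin-false : ∀ k (g : Fin k → Bool) → anyFin k g ≡ false → ∀ h → g h ≡ false
anyFin-false (suc k) g e h with g zero in g0
anyFin-false (suc k) g e zero    | false = g0
anyFin-false (suc k) g e (suc h) | false = anyFin-false k (g ∘ suc) e h

anyFin-witness : ∀ k (g : Fin k → Bool) → anyFin k g ≡ true → Σ (Fin k) (λ h → g h ≡ true)
anyFin-witness (suc k) g e with g zero in g0
... | true  = zero , g0
... | false = let h , gh = anyFin-witness k (g ∘ suc) e in suc h , gh

witness⇒anyFin : ∀ k (g : Fin k → Bool) h → g h ≡ true → anyFin k g ≡ true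
witness⇒anyFin (suc k) g zero    gh rewrite gh = refl
witness⇒anyFin (suc k) g (suc h) gh with g zero
... | true  = refl
... | false = witness⇒anyFin k (g ∘ suc) h gh

allFin-true : ∀ k (g : Fin k → Bool) → allFin k g ≡ true → ∀ h → g h ≡ true
allFin-true (suc k) g e h with g zero in g0
allFin-true (suc k) g e zero    | true = g0
allFin-true (suc k) g e (suc h) | true = allFin-true k (g ∘ suc) e h

allFin-counterexample : ∀ k (g : Fin k → Bool) → allFin k g ≡ false → Σ (Fin k) (λ h → g h ≡ false)
allFin-counterexample (suc k) g e with g zero in g0
... | false = zero , g0
... | true  = let h , gh = allFin-counterexample k (g ∘ suc) e in suc h , gh

AtMostOne : ∀ {k} → (Fin k → Bool) → Set
AtMostOne g = ∀ j j' → g j ≡ true → g j' ≡ true → j ≡ j'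

𝟙-anyFin≤∑ : ∀ k (g : Fin k → Bool) → 𝟙 (anyFin k g) ≤ ∑ k (𝟙 ∘ g)
𝟙-anyFin≤∑ zero    g = z≤n
𝟙-anyFin≤∑ (suc k) g with g zero
... | true  = s≤s z≤n
... | false = 𝟙-anyFin≤∑ k (g ∘ suc)

𝟙-anyFin≡∑ : ∀ k (g : Fin k → Bool) → AtMostOne g → 𝟙 (anyFin k g) ≡ ∑ k (𝟙 ∘ g)
𝟙-anyFin≡∑ zero    g one = refl
𝟙-anyFin≡∑ (suc k) g one with g zero in g0
... | true  = sym (cong suc (∑-zero k (λ j → cong 𝟙 (others j))))
  where
  others : ∀ j → g (suc j) ≡ false
  others j with g (suc j) in gj
  ... | false = refl
  ... | true with () ← one zero (suc j) g0 gj
... | false = 𝟙-anyFin≡∑ k (g ∘ suc) (λ j j' gj gj' → FP.suc-injective (one (suc j) (suc j') gj gj'))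

first : ∀ k → (Fin k → Bool) → Maybe (Fin k)
first zero    g = nothing
first (suc k) g = if g zero then just zero else Data.Maybe.map suc (first k (g ∘ suc))

first-just : ∀ k g j → first k g ≡ just j → g j ≡ true
first-just (suc k) g j e with g zero in g0
first-just (suc k) g .zero refl | true = g0
... | false with first k (g ∘ suc) in e′
first-just (suc k) g .(suc j) refl | false | just j = first-just k (g ∘ suc) j e′

first-nothing : ∀ k g → first k g ≡ nothing → ∀ j → g j ≡ false
first-nothing (suc k) g e j with g zero in g0
... | false with first k (g ∘ suc) in e′
first-nothing (suc k) g refl zero    | false | nothing = g0
first-nothing (suc k) g refl (suc j) | false | nothing = first-nothing k (g ∘ suc) e′ j

first-unique : ∀ k g j → AtMostOne g → g j ≡ true → first k g ≡ just j
first-unique (suc k) g j one gj with g zero in g0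
... | true = cong just (one zero j g0 gj)
first-unique (suc k) g zero    one gj | false with () ← trans (sym g0) gj
first-unique (suc k) g (suc j) one gj | false
  rewrite first-unique k (g ∘ suc) j (λ i i' gi gi' → FP.suc-injective (one (suc i) (suc i') gi gi')) gj = refl

first-none : ∀ k g → (∀ j → g j ≡ false) → first k g ≡ nothing
first-none zero    g none = refl
first-none (suc k) g none rewrite none zero | first-none k (g ∘ suc) (none ∘ suc) = refl

_is_ : ∀ {k} → Maybe (Fin k) → Fin k → Bool
nothing is j = false
just i  is j = ⌊ i F.≟ j ⌋

first-is : ∀ k g → AtMostOne g → ∀ j → first k g is j ≡ g j
first-is k g one j with g j in gj
... | true rewrite first-unique k g j one gj with j F.≟ j
...   | yes _ = refl
...   | no j≢j = ⊥-elim (j≢j refl)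
first-is k g one j | false with first k g in e
... | nothing = refl
... | just i with i F.≟ j
...   | no _ = refl
...   | yes refl with () ← trans (sym gj) (first-just k g i e)

module _ {A B : Set} where

  ∈-concatMap⁺′ : ∀ {x : A} {xs} {z : B} (g : A → List B) → x ∈ xs → z ∈ g x → z ∈ concatMap g xs
  ∈-concatMap⁺′ g x∈xs z∈gx = ∈-concatMap⁺ g (lose x∈xs z∈gx)

  All-concatMap⁺ : ∀ {P : B → Set} (g : A → List B) xs → (∀ x → All P (g x)) → All P (concatMap g xs)
  All-concatMap⁺ g xs all = AllP.concat⁺ (AllP.map⁺ (All.tabulate {xs = xs} (λ {x} _ → all x)))

  Unique-concatMap⁺ : ∀ {xs} (g : A → List B) (key : B → A) →
                      (∀ x → All (λ z → key z ≡ x) (g x)) → (∀ x → Unique (g x)) → Unique xs →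
                      Unique (concatMap g xs)
  Unique-concatMap⁺ g key keyed unique xs! =
    UP.concat⁺ (AllP.map⁺ (All.tabulate (λ {x} _ → unique x)))
               (AllPairsP.map⁺ (AllPairs.map disjoint xs!))
    where
    disjoint : ∀ {x y} → x ≢ y → Disjoint (g x) (g y)
    disjoint x≢y (z∈gx , z∈gy) = x≢y (trans (sym (All.lookup (keyed _) z∈gx)) (All.lookup (keyed _) z∈gy))

lookup-injective : ∀ {A : Set} {xs : List A} → Unique xs → ∀ i j → L.lookup xs i ≡ L.lookup xs j → i ≡ j
lookup-injective (x∉ ∷ u) zero    zero    e = refl
lookup-injective (x∉ ∷ u) zero    (suc j) e = ⊥-elim (All.lookup x∉ (∈-lookup j) e)
lookup-injective (x∉ ∷ u) (suc i) zero    e = ⊥-elim (All.lookup x∉ (∈-lookup i) (sym e))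
lookup-injective (x∉ ∷ u) (suc i) (suc j) e = cong suc (lookup-injective u i j e)

lookup-++ : ∀ {A : Set} {P Q : A → Set} xs ys → All P xs → All Q ys → ∀ j →
            (toℕ j < length xs → P (L.lookup (xs ++ ys) j)) × (length xs ≤ toℕ j → Q (L.lookup (xs ++ ys) j))
lookup-++ []       ys ps       qs j       = (λ ()) , (λ _ → All.lookup qs (∈-lookup j))
lookup-++ (x ∷ xs) ys (px ∷ _) qs zero    = (λ _ → px) , (λ ())
lookup-++ (x ∷ xs) ys (_ ∷ ps) qs (suc j) =
  (λ { (s≤s l) → proj₁ (lookup-++ xs ys ps qs j) l }) , (λ { (s≤s l) → proj₂ (lookup-++ xs ys ps qs j) l })

filterᵇ-true : ∀ {A : Set} (p : A → Bool) xs → All (λ x → p x ≡ true) (filterᵇ p xs)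
filterᵇ-true p xs = All.map (Equivalence.to T-≡) (AllP.all-filter (T? ∘ p) xs)

∈-filterᵇ⁺ : ∀ {A : Set} (p : A → Bool) {x xs} → x ∈ xs → p x ≡ true → x ∈ filterᵇ p xs
∈-filterᵇ⁺ p x∈xs px = ∈-filter⁺ (T? ∘ p) x∈xs (true⇒T px)

allVecs-complete : ∀ n (v : Vec Bool n) → v ∈ allVecs n
allVecs-complete zero    []      = here refl
allVecs-complete (suc n) (b ∷ v) = ∈-concatMap⁺′ _ (allVecs-complete n v) (head∈ b)
  where
  head∈ : ∀ b → (b ∷ v) ∈ ((true ∷ v) ∷ (false ∷ v) ∷ [])
  head∈ true  = here refl
  head∈ false = there (here refl)

allVecs-unique : ∀ n → Unique (allVecs n)
allVecs-unique zero    = [] ∷ []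
allVecs-unique (suc n) = Unique-concatMap⁺ _ V.tail (λ v → refl ∷ refl ∷ [])
                           (λ v → ((λ ()) ∷ []) ∷ [] ∷ []) (allVecs-unique n)

==v⇒≡ : ∀ {n} (u v : Vec Bool n) → (u ==v v) ≡ true → u ≡ v
==v⇒≡ u v e with VP.≡-dec B._≟_ u v
... | yes u≡v = u≡v

==v-refl : ∀ {n} (u : Vec Bool n) → (u ==v u) ≡ true
==v-refl u with VP.≡-dec B._≟_ u u
... | yes _   = refl
... | no u≢u = ⊥-elim (u≢u refl)

module Enumeration (nU nB : ℕ) where
  open Types nU nB
  open TwoType

  ==1⇒≡ : ∀ (s t : OneType nU nB) → (s ==1 t) ≡ true → s ≡ t
  ==1⇒≡ (u , b) (u′ , b′) e with u ==v u′ in eu | b ==v b′ in eb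
  ... | true | true = cong₂ _,_ (==v⇒≡ u u′ eu) (==v⇒≡ b b′ eb)

  ≡⇒==1 : ∀ {s t : OneType nU nB} → s ≡ t → (s ==1 t) ≡ true
  ≡⇒==1 {u , b} refl rewrite ==v-refl u | ==v-refl b = refl

  all1-complete : ∀ t → t ∈ all1
  all1-complete (u , b) = ∈-concatMap⁺′ _ (allVecs-complete nU u) (∈-map⁺ (u ,_) (allVecs-complete nB b))

  -- Opaque, so that type checking never unfolds the enumeration all1 behind ι.
  opaque
    ι : OneType nU nB → Fin Lₜ
    ι t = index (all1-complete t)

    π-ι : ∀ t → π (ι t) ≡ t
    π-ι t = sym (lookup-index (all1-complete t))

  all2-complete : ∀ τ → τ ∈ all2
  all2-complete (mk2 a b c d e g) =
    ∈-concatMap⁺′ _ (allVecs-complete nU a) (∈-concatMap⁺′ _ (allVecs-complete nU b)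
      (∈-concatMap⁺′ _ (allVecs-complete nB c) (∈-concatMap⁺′ _ (allVecs-complete nB d)
        (∈-concatMap⁺′ _ (allVecs-complete nB e) (∈-map⁺ (mk2 a b c d e) (allVecs-complete nB g))))))

  -- Each level of the nested enumeration fixes one more field, which is the key separating its blocks.
  all2-unique : Unique all2
  all2-unique =
    Unique-concatMap⁺ L1 ux key₁ (λ a →
      Unique-concatMap⁺ (L2 a) uy (key₂ a) (λ b →
        Unique-concatMap⁺ (L3 a b) bxx (key₃ a b) (λ c →
          Unique-concatMap⁺ (L4 a b c) bxy (key₄ a b c) (λ d →
            Unique-concatMap⁺ (L5 a b c d) byx (key₅ a b c d) (λ e →
              UP.map⁺ (cong byy) (allVecs-unique nB))
            (allVecs-unique nB))
          (allVecs-unique nB))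
        (allVecs-unique nB))
      (allVecs-unique nU))
    (allVecs-unique nU)
    where
    vU : List (Vec Bool nU)
    vU = allVecs nU
    vB : List (Vec Bool nB)
    vB = allVecs nB
    L5 : Vec Bool nU → Vec Bool nU → Vec Bool nB → Vec Bool nB → Vec Bool nB → List (TwoType nU nB)
    L5 a b c d e = L.map (mk2 a b c d e) vB
    L4 : Vec Bool nU → Vec Bool nU → Vec Bool nB → Vec Bool nB → List (TwoType nU nB)
    L4 a b c d = concatMap (L5 a b c d) vB
    L3 : Vec Bool nU → Vec Bool nU → Vec Bool nB → List (TwoType nU nB)
    L3 a b c = concatMap (L4 a b c) vB
    L2 : Vec Bool nU → Vec Bool nU → List (TwoType nU nB)
    L2 a b = concatMap (L3 a b) vB
    L1 : Vec Bool nU → List (TwoType nU nB)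
    L1 a = concatMap (L2 a) vU
    leaf : ∀ {P : TwoType nU nB → Set} a b c d e → (∀ g → P (mk2 a b c d e g)) → All P (L5 a b c d e)
    leaf a b c d e Pg = AllP.map⁺ (All.tabulate (λ {g} _ → Pg g))
    key₅ : ∀ a b c d e → All (λ z → byx z ≡ e) (L5 a b c d e)
    key₅ a b c d e = leaf a b c d e (λ _ → refl)
    key₄ : ∀ a b c d → All (λ z → bxy z ≡ d) (L4 a b c d)
    key₄ a b c d = All-concatMap⁺ (L5 a b c d) vB (λ e → leaf a b c d e (λ _ → refl))
    key₃ : ∀ a b c → All (λ z → bxx z ≡ c) (L3 a b c)
    key₃ a b c = All-concatMap⁺ (L4 a b c) vB λ d → All-concatMap⁺ (L5 a b c d) vB (λ e → leaf a b c d e (λ _ → refl))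
    key₂ : ∀ a b → All (λ z → uy z ≡ b) (L2 a b)
    key₂ a b = All-concatMap⁺ (L3 a b) vB λ c → All-concatMap⁺ (L4 a b c) vB λ d →
               All-concatMap⁺ (L5 a b c d) vB (λ e → leaf a b c d e (λ _ → refl))
    key₁ : ∀ a → All (λ z → ux z ≡ a) (L1 a)
    key₁ a = All-concatMap⁺ (L2 a) vU λ b → All-concatMap⁺ (L3 a b) vB λ c → All-concatMap⁺ (L4 a b c) vB λ d →
             All-concatMap⁺ (L5 a b c d) vB (λ e → leaf a b c d e (λ _ → refl))

module Messages (nU nB m : ℕ) (f : Fin m → Fin nB) where
  open Ctx nU nB m f
  open Enumeration nU nB

  private
    oneWay : TwoType nU nB → Bool
    oneWay τ = isMsg τ ∧ not (invertible τ)

    μ-class : ∀ j → (toℕ j < M* → invertible (μ j) ≡ true) × (M* ≤ toℕ j → oneWay (μ j) ≡ true)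
    μ-class = lookup-++ invMsgs _ (filterᵇ-true invertible all2) (filterᵇ-true oneWay all2)

  μ-invertible : ∀ j → toℕ j < M* → invertible (μ j) ≡ true
  μ-invertible j = proj₁ (μ-class j)

  μ-isMsg : ∀ j → isMsg (μ j) ≡ true
  μ-isMsg j with toℕ j <? M*
  ... | yes j<M* = ∧-true-left _ (μ-invertible j j<M*)
  ... | no  j≮M* = ∧-true-left _ (proj₂ (μ-class j) (≮⇒≥ j≮M*))

  inv-μ-silent : ∀ j → M* ≤ toℕ j → isMsg (inv (μ j)) ≡ false
  inv-μ-silent j M*≤j with proj₂ (μ-class j) M*≤j
  ... | e rewrite μ-isMsg j with isMsg (inv (μ j))
  ... | false = refl

  invertible⇒<M* : ∀ j → invertible (μ j) ≡ true → toℕ j < M*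
  invertible⇒<M* j e with toℕ j <? M*
  ... | yes j<M* = j<M*
  ... | no  j≮M* with () ← trans (sym (∧-true-right (isMsg (μ j)) (proj₂ (μ-class j) (≮⇒≥ j≮M*)))) (cong not e)

  μ-injective : ∀ i j → μ i ≡ μ j → i ≡ j
  μ-injective = lookup-injective (UP.++⁺ (UP.filter⁺ _ all2-unique) (UP.filter⁺ _ all2-unique) disjoint)
    where
    disjoint : Disjoint invMsgs (filterᵇ oneWay all2)
    disjoint {τ} (τ∈inv , τ∈oneWay) with () ←
      trans (sym (∧-true-right (isMsg τ) (All.lookup (filterᵇ-true oneWay all2) τ∈oneWay)))
            (cong not (All.lookup (filterᵇ-true invertible all2) τ∈inv))

  inv-μ∈allMsgs : ∀ j → toℕ j < M* → inv (μ j) ∈ allMsgs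
  inv-μ∈allMsgs j j<M* = ∈-++⁺ˡ (∈-filterᵇ⁺ invertible (all2-complete _)
                           (trans (∧-comm (isMsg (inv (μ j))) (isMsg (μ j))) (μ-invertible j j<M*)))

  -- For one-way message types μ⁻ j is the junk value j.
  opaque
    μ⁻ : Fin M → Fin M
    μ⁻ j with toℕ j <? M*
    ... | yes j<M* = index (inv-μ∈allMsgs j j<M*)
    ... | no _     = j

    μ-μ⁻ : ∀ j → toℕ j < M* → μ (μ⁻ j) ≡ inv (μ j)
    μ-μ⁻ j j<M* with toℕ j <? M*
    ... | yes j<M*′ = sym (lookup-index (inv-μ∈allMsgs j j<M*′))
    ... | no  j≮M*  = ⊥-elim (j≮M* j<M*)

  μ⁻<M* : ∀ j → toℕ j < M* → toℕ (μ⁻ j) < M*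
  μ⁻<M* j j<M* = invertible⇒<M* (μ⁻ j)
    (trans (cong invertible (μ-μ⁻ j j<M*)) (trans (∧-comm (isMsg (inv (μ j))) _) (μ-invertible j j<M*)))

  μ⁻-involutive : ∀ j → toℕ j < M* → μ⁻ (μ⁻ j) ≡ j
  μ⁻-involutive j j<M* = μ-injective _ _ (trans (μ-μ⁻ (μ⁻ j) (μ⁻<M* j j<M*)) (cong inv (μ-μ⁻ j j<M*)))

eval-cong : ∀ {nU nB k} {U U′ : Fin nU → Fin k → Bool} {R R′ : Fin nB → Fin k → Fin k → Bool} →
            (∀ P v → U P v ≡ U′ P v) → (∀ Q v v′ → R Q v v′ ≡ R′ Q v v′) → ∀ φ → eval U R φ ≡ eval U′ R′ φ
eval-cong eU eR (un P v)    = eU P v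
eval-cong eU eR (bin Q v w) = eR Q v w
eval-cong eU eR ⊤f          = refl
eval-cong eU eR ⊥f          = refl
eval-cong eU eR (¬f φ)      = cong not (eval-cong eU eR φ)
eval-cong eU eR (φ ∧f ψ)    = cong₂ _∧_ (eval-cong eU eR φ) (eval-cong eU eR ψ)
eval-cong eU eR (φ ∨f ψ)    = cong₂ _∨_ (eval-cong eU eR φ) (eval-cong eU eR ψ)

eval-cong₂ : ∀ {nU nB} {U U′ : Fin nU → Fin 2 → Bool} {R R′ : Fin nB → Fin 2 → Fin 2 → Bool} →
             (∀ P → U P zero ≡ U′ P zero) → (∀ P → U P (suc zero) ≡ U′ P (suc zero)) →
             (∀ Q → R Q zero zero ≡ R′ Q zero zero) → (∀ Q → R Q zero (suc zero) ≡ R′ Q zero (suc zero)) →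
             (∀ Q → R Q (suc zero) zero ≡ R′ Q (suc zero) zero) → (∀ Q → R Q (suc zero) (suc zero) ≡ R′ Q (suc zero) (suc zero)) →
             ∀ φ → eval U R φ ≡ eval U′ R′ φ
eval-cong₂ {U = U} {U′} {R} {R′} x y xx xy yx yy = eval-cong eU eR
  where
  eU : ∀ P v → U P v ≡ U′ P v
  eU P zero       = x P
  eU P (suc zero) = y P
  eR : ∀ Q v v′ → R Q v v′ ≡ R′ Q v v′
  eR Q zero       zero       = xx Q
  eR Q zero       (suc zero) = xy Q
  eR Q (suc zero) zero       = yx Q
  eR Q (suc zero) (suc zero) = yy Q

module Construction
  {nU nB m : ℕ} {f : Fin m → Fin nB} {C : Fin m → ℕ} {α : Fm nU nB 1} {β : Fm nU nB 2}
  (𝓕 : Ctx.Frame nU nB m f) (chromatic : Ctx.IsChromatic nU nB m f 𝓕)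
  {Z : ℕ} (Z-large : 3 * m * maxFin m C ∸ 1 ≤ Z)
  {w : Fin (Ctx.Frame.N 𝓕) → ℕ} (solution : Ctx.IsSolution nU nB m f 𝓕 Z w)
  (models : Ctx.FrameModels nU nB m f 𝓕 α β C)
  (size : ℕ) (starOf : Fin (suc size) → Fin (Ctx.Frame.N 𝓕))
  (starOf-sum : ∀ (g : Fin (Ctx.Frame.N 𝓕) → ℕ) → ∑ (suc size) (g ∘ starOf) ≡ ∑ (Ctx.Frame.N 𝓕) (λ k → w k * g k))
  where

  open Ctx nU nB m f
  open Frame 𝓕
  open Enumeration nU nB
  open Messages nU nB m f
  open TwoType

  n : ℕ
  n = suc size

  tp : Fin n → OneType nU nB
  tp a = tpσ 𝓕 (starOf a)

  out : Fin n → Fin M → ℕ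
  out a j = _[_] 𝓕 (starOf a) j

  u : OneType nU nB → ℕ
  u t = uₛ 𝓕 w (ι t)

  D : ℕ
  D = m * maxFin m C

  royal : OneType nU nB → Bool
  royal t = u t ≤ᵇ 1

  invᵇ : Fin M → Bool
  invᵇ j = toℕ j <ᵇ M*

  oneWayᵇ : Fin M → Bool
  oneWayᵇ j = M* <ᵇ suc (toℕ j)

  hasType : OneType nU nB → Fin n → Bool
  hasType t c = tp c ==1 t

  sends : Fin M → Fin n → Bool
  sends j a = 0 <ᵇ out a j

  invertibleTo : Fin N → OneType nU nB → ℕ
  invertibleTo k t = ∑ M (λ j → if invᵇ j ∧ (tp2 (μ j) ==1 t) then _[_] 𝓕 k j else 0)

  s≤u : ∀ i k → s 𝓕 i k ≤ uₛ 𝓕 w i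
  s≤u = proj₁ (proj₂ (proj₂ solution))

  u≤1⊎Z<u : ∀ i → uₛ 𝓕 w i ≤ 1 ⊎ Z < uₛ 𝓕 w i
  u≤1⊎Z<u = proj₁ (proj₂ (proj₂ (proj₂ solution)))

  royal-room : ∀ i i′ k → o 𝓕 i k ≡ 1 → 1 < uₛ 𝓕 w i ⊎ r 𝓕 i′ k ≤ xₛ 𝓕 w i′ i
  royal-room = proj₁ (proj₂ (proj₂ (proj₂ (proj₂ solution))))

  commoners-in-I : ∀ i i′ → inI 𝓕 i i′ ≡ false → uₛ 𝓕 w i ≤ 1 ⊎ uₛ 𝓕 w i′ ≤ 1
  commoners-in-I = proj₁ (proj₂ (proj₂ (proj₂ (proj₂ (proj₂ solution)))))

  royal-room-tight : ∀ i i′ k → inI 𝓕 i i′ ≡ false → o 𝓕 i k ≡ 1 → 1 < uₛ 𝓕 w i ⊎ xₛ 𝓕 w i′ i ≤ r 𝓕 i′ k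
  royal-room-tight = proj₂ (proj₂ (proj₂ (proj₂ (proj₂ (proj₂ solution)))))

  count-starOf : ∀ (g : Fin N → Bool) → count n (g ∘ starOf) ≡ ∑ N (λ k → w k * 𝟙 (g k))
  count-starOf g = starOf-sum (𝟙 ∘ g)

  count-hasType : ∀ t → count n (hasType t) ≡ u t
  count-hasType t = trans (count-starOf (λ k → tpσ 𝓕 k ==1 t)) (∑-cong N λ k →
    trans (*-comm (w k) _) (cong (λ t′ → 𝟙 (tpσ 𝓕 k ==1 t′) * w k) (sym (π-ι t))))

  oneWayᵇ≡not-invᵇ : ∀ j → oneWayᵇ j ≡ not (invᵇ j)
  oneWayᵇ≡not-invᵇ j with toℕ j <? M*
  ... | yes j<M* rewrite <⇒<ᵇ′ j<M* = ≮⇒<ᵇ≡false (λ lt → <⇒≱ j<M* (m<1+n⇒m≤n lt))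
  ... | no  j≮M* rewrite ≮⇒<ᵇ≡false j≮M* = <⇒<ᵇ′ (s≤s (≮⇒≥ j≮M*))

  invertibleTo-term : ∀ k j → invᵇ j ≡ true → _[_] 𝓕 k j ≤ invertibleTo k (tp2 (μ j))
  invertibleTo-term k j inv-j = subst (_≤ invertibleTo k (tp2 (μ j))) (if-true (cong₂ _∧_ inv-j (≡⇒==1 {tp2 (μ j)} refl)))
                            (term≤∑ M _ j)

  invertibleTo≤1 : ∀ k t → invertibleTo k t ≤ 1
  invertibleTo≤1 k t = proj₁ (chromatic k t)

  inv-out≤1 : ∀ k j → invᵇ j ≡ true → _[_] 𝓕 k j ≤ 1
  inv-out≤1 k j inv-j = ≤-trans (invertibleTo-term k j inv-j) (invertibleTo≤1 k _)

  inv-target≢own : ∀ k j → invᵇ j ≡ true → 0 < _[_] 𝓕 k j → tp2 (μ j) ≢ tpσ 𝓕 k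
  inv-target≢own k j inv-j pos eq =
    <⇒≢ (≤-trans pos (invertibleTo-term k j inv-j)) (sym (proj₂ (chromatic k (tp2 (μ j))) eq))

  inv-target-unique : ∀ k j j′ → invᵇ j ≡ true → invᵇ j′ ≡ true → 0 < _[_] 𝓕 k j → 0 < _[_] 𝓕 k j′ →
                      tp2 (μ j) ≡ tp2 (μ j′) → j ≡ j′
  inv-target-unique k j j′ inv-j inv-j′ pos pos′ eq = [ id , (λ j≢j′ → ⊥-elim (<-irrefl refl (begin-strict
    1                                 <⟨ +-mono-≤ pos pos′ ⟩
    _[_] 𝓕 k j + _[_] 𝓕 k j′          ≡⟨ cong₂ _+_ (at j inv-j refl) (at j′ inv-j′ (sym eq)) ⟨
    to-t j + to-t j′                  ≤⟨ two-terms≤∑ M to-t j j′ j≢j′ ⟩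
    invertibleTo k (tp2 (μ j))        ≤⟨ invertibleTo≤1 k (tp2 (μ j)) ⟩
    1                                 ∎))) ]′ (toSum (j F.≟ j′))
    where
    open ≤-Reasoning
    to-t : Fin M → ℕ
    to-t i = if invᵇ i ∧ (tp2 (μ i) ==1 tp2 (μ j)) then _[_] 𝓕 k i else 0
    at : ∀ i → invᵇ i ≡ true → tp2 (μ i) ≡ tp2 (μ j) → to-t i ≡ _[_] 𝓕 k i
    at i inv-i eq′ = if-true (cong₂ _∧_ inv-i (≡⇒==1 {tp2 (μ i)} eq′))

  𝟙-pos : ∀ x → x ≤ 1 → 𝟙 (0 <ᵇ x) ≡ x
  𝟙-pos zero          _ = refl
  𝟙-pos (suc zero)    _ = refl
  𝟙-pos (suc (suc x)) (s≤s ())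

  count-sends : ∀ j → invᵇ j ≡ true → count n (sends j) ≡ vₛ 𝓕 w j
  count-sends j inv-j = trans (count-starOf (λ k → 0 <ᵇ _[_] 𝓕 k j))
    (∑-cong N (λ k → trans (*-comm (w k) _) (cong (_* w k) (𝟙-pos _ (inv-out≤1 k j inv-j)))))

  royal⇒u≤1 : ∀ t → royal t ≡ true → u t ≤ 1
  royal⇒u≤1 t = ≤ᵇ⇒≤′

  royal-unique : ∀ t a b → royal t ≡ true → tp a ≡ t → tp b ≡ t → a ≡ b
  royal-unique t a b royal-t tp-a tp-b with a F.≟ b
  ... | yes a≡b = a≡b
  ... | no  a≢b = ⊥-elim (<-irrefl refl (≤-trans
        (two-witnesses⇒count≥2 n (hasType t) a b a≢b (≡⇒==1 tp-a) (≡⇒==1 tp-b))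
        (≤-trans (≤-reflexive (count-hasType t)) (royal⇒u≤1 t royal-t))))

  nonroyal⇒3D≤u : ∀ t → royal t ≡ false → 3 * D ≤ u t
  nonroyal⇒3D≤u t nonroyal = large (u≤1⊎Z<u (ι t))
    where
    large : u t ≤ 1 ⊎ Z < u t → 3 * D ≤ u t
    large (inj₁ u≤1) with () ← trans (sym nonroyal) (≤⇒≤ᵇ′ u≤1)
    large (inj₂ Z<u) = begin
      3 * D                          ≡⟨ *-assoc 3 m (maxFin m C) ⟨
      3 * m * maxFin m C             ≤⟨ m≤n+m∸n (3 * m * maxFin m C) 1 ⟩
      1 + (3 * m * maxFin m C ∸ 1)   ≤⟨ +-monoʳ-≤ 1 Z-large ⟩
      1 + Z                          ≤⟨ Z<u ⟩
      u t                            ∎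
      where open ≤-Reasoning

  -- Invertible messages

  tp1-μ : ∀ a j → 0 < out a j → tp1 (μ j) ≡ tp a
  tp1-μ a j = star (starOf a) j

  tp2-μ⁻ : ∀ a j → invᵇ j ≡ true → 0 < out a j → tp2 (μ (μ⁻ j)) ≡ tp a
  tp2-μ⁻ a j inv-j pos = trans (cong tp2 (μ-μ⁻ j (<ᵇ⇒<′ inv-j))) (tp1-μ a j pos)

  invᵇ-μ⁻ : ∀ j → invᵇ j ≡ true → invᵇ (μ⁻ j) ≡ true
  invᵇ-μ⁻ j inv-j = <⇒<ᵇ′ (μ⁻<M* j (<ᵇ⇒<′ inv-j))

  matched : Fin M → Fin n → Fin n → Bool
  matched j a b = invᵇ j ∧ (sends j a ∧ (sends (μ⁻ j) b ∧ ⌊ rank n (sends (μ⁻ j)) b ≟ rank n (sends j) a ⌋))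

  matched⇒ : ∀ j a b → matched j a b ≡ true →
             (invᵇ j ≡ true) × (0 < out a j) × (0 < out b (μ⁻ j)) × (tp2 (μ j) ≡ tp b)
  matched⇒ j a b e = inv-j , <ᵇ⇒<′ sa , <ᵇ⇒<′ sb ,
                     trans (cong tp1 (sym (μ-μ⁻ j (<ᵇ⇒<′ inv-j)))) (tp1-μ b (μ⁻ j) (<ᵇ⇒<′ sb))
    where
    inv-j : invᵇ j ≡ true
    inv-j = ∧-true-left (invᵇ j) e
    sa : sends j a ≡ true
    sa = ∧-true-left (sends j a) (∧-true-right (invᵇ j) e)
    sb : sends (μ⁻ j) b ≡ true
    sb = ∧-true-left (sends (μ⁻ j) b) (∧-true-right (sends j a) (∧-true-right (invᵇ j) e))

  matched-sym : ∀ j a b → matched j a b ≡ true → matched (μ⁻ j) b a ≡ true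
  matched-sym j a b e = subst (λ i → (invᵇ (μ⁻ j) ∧ (sends (μ⁻ j) b ∧ (sends i a ∧ same i))) ≡ true)
    (sym (μ⁻-involutive j (<ᵇ⇒<′ inv-j)))
    (∧-true-intro (invᵇ-μ⁻ j inv-j) (∧-true-intro sb (∧-true-intro sa
      (trans (⌊≟⌋-sym (rank n (sends j) a) _) (∧-true-right (sends (μ⁻ j) b) rest)))))
    where
    same : Fin M → Bool
    same i = ⌊ rank n (sends i) a ≟ rank n (sends (μ⁻ j)) b ⌋
    inv-j : invᵇ j ≡ true
    inv-j = ∧-true-left (invᵇ j) e
    sa : sends j a ≡ true
    sa = ∧-true-left (sends j a) (∧-true-right (invᵇ j) e)
    rest : (sends (μ⁻ j) b ∧ ⌊ rank n (sends (μ⁻ j)) b ≟ rank n (sends j) a ⌋) ≡ true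
    rest = ∧-true-right (sends j a) (∧-true-right (invᵇ j) e)
    sb : sends (μ⁻ j) b ≡ true
    sb = ∧-true-left (sends (μ⁻ j) b) rest

  matched-invᵇ : ∀ j a b → invᵇ j ≡ false → matched j a b ≡ false
  matched-invᵇ j a b one-way = cong (_∧ (sends j a ∧ (sends (μ⁻ j) b ∧ ⌊ rank n (sends (μ⁻ j)) b ≟ rank n (sends j) a ⌋))) one-way

  count-matched : ∀ a j → invᵇ j ≡ true → count n (matched j a) ≡ out a j
  count-matched a j inv-j = bool-cases (sends j a) sending idle
    where
    open ≡-Reasoning
    same-rank : Fin n → Bool
    same-rank b = sends (μ⁻ j) b ∧ ⌊ rank n (sends (μ⁻ j)) b ≟ rank n (sends j) a ⌋
    idle : sends j a ≡ false → count n (matched j a) ≡ out a j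
    idle sa = trans (count-zero n {matched j a} (λ b → cong₂ (λ x y → x ∧ (y ∧ same-rank b)) inv-j sa))
                      (sym (n≤0⇒n≡0 (<ᵇ≡false⇒≥ sa)))
    balanced : count n (sends j) ≡ count n (sends (μ⁻ j))
    balanced = trans (count-sends j inv-j)
      (trans (proj₁ (proj₂ solution) j (μ⁻ j) (<ᵇ⇒<′ inv-j) (μ-μ⁻ j (<ᵇ⇒<′ inv-j)))
             (sym (count-sends (μ⁻ j) (invᵇ-μ⁻ j inv-j))))
    sending : sends j a ≡ true → count n (matched j a) ≡ out a j
    sending sa = begin
      count n (matched j a)  ≡⟨ count-cong n {matched j a} (λ b → cong₂ (λ x y → x ∧ (y ∧ same-rank b)) inv-j sa) ⟩
      count n same-rank      ≡⟨ count-rank≡ n (sends (μ⁻ j)) _ (≤-trans (rank<count n (sends j) a sa) (≤-reflexive balanced)) ⟩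
      1                      ≡⟨ ≤-antisym (<ᵇ⇒<′ sa) (inv-out≤1 (starOf a) j inv-j) ⟩
      out a j                ∎

  -- One-way messages

  position : Fin n → ℕ
  position c = rank n (hasType (tp c)) c

  inBlock : ℕ → Fin n → Bool
  inBlock g c = inWindow (g * D) D (position c)

  block : Fin n → ℕ
  block c = if inBlock 0 c then 0 else if inBlock 1 c then 1 else if inBlock 2 c then 2 else 3

  next : ℕ → ℕ
  next 0 = 1
  next 1 = 2
  next _ = 0

  next≤2 : ∀ x → next x ≤ 2
  next≤2 0             = s≤s z≤n
  next≤2 1             = s≤s (s≤s z≤n)
  next≤2 (suc (suc x)) = z≤n

  next-irreflexive : ∀ x → x ≢ next x
  next-irreflexive 0 ()
  next-irreflexive 1 ()
  next-irreflexive (suc (suc x)) ()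

  next²-irreflexive : ∀ x → x ≢ next (next x)
  next²-irreflexive 0 ()
  next²-irreflexive 1 ()
  next²-irreflexive 2 ()
  next²-irreflexive (suc (suc (suc x))) ()

  inBlock-< : ∀ g g′ c → g < g′ → inBlock g c ≡ true → inBlock g′ c ≡ true → ⊥
  inBlock-< g g′ c g<g′ in-g in-g′ = <-irrefl refl (begin-strict
    position c      <⟨ proj₂ (inWindow⇒bounds (g * D) D in-g) ⟩
    g * D + D       ≡⟨ +-comm (g * D) D ⟩
    suc g * D       ≤⟨ *-monoˡ-≤ D g<g′ ⟩
    g′ * D          ≤⟨ proj₁ (inWindow⇒bounds (g′ * D) D in-g′) ⟩
    position c      ∎)
    where open ≤-Reasoning

  inBlock-disjoint : ∀ g g′ c → inBlock g c ≡ true → inBlock g′ c ≡ true → g ≡ g′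
  inBlock-disjoint g g′ c in-g in-g′ = compare (<-cmp g g′)
    where
    compare : Tri (g < g′) (g ≡ g′) (g′ < g) → g ≡ g′
    compare (tri≈ _ g≡g′ _) = g≡g′
    compare (tri< g<g′ _ _) = ⊥-elim (inBlock-< g g′ c g<g′ in-g in-g′)
    compare (tri> _ _ g′<g) = ⊥-elim (inBlock-< g′ g c g′<g in-g′ in-g)

  inBlock⇒block : ∀ g c → inBlock g c ≡ true → g ≤ 2 → block c ≡ g
  inBlock⇒block g c in-g g≤2 with inBlock 0 c in in₀
  ... | true = inBlock-disjoint 0 g c in₀ in-g
  ... | false with inBlock 1 c in in₁
  ...   | true = inBlock-disjoint 1 g c in₁ in-g
  ...   | false with inBlock 2 c in in₂
  ...     | true = inBlock-disjoint 2 g c in₂ in-g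
  ...     | false = ⊥-elim (none g g≤2 in-g)
    where
    none : ∀ g → g ≤ 2 → inBlock g c ≡ true → ⊥
    none 0 _ e with () ← trans (sym in₀) e
    none 1 _ e with () ← trans (sym in₁) e
    none 2 _ e with () ← trans (sym in₂) e
    none (suc (suc (suc _))) (s≤s (s≤s ())) _

  silentTo : OneType nU nB → Fin n → Bool
  silentTo t e = allFin M (λ j → if tp2 (μ j) ==1 π (ι t) then ⌊ out e j ≟ 0 ⌋ else true)

  silentTo⇒ : ∀ t b j → silentTo t b ≡ true → 0 < out b j → tp2 (μ j) ≢ t
  silentTo⇒ t b j silent-b pos tj = <-irrefl (sym (⌊≟⌋⇒≡ out≡0)) pos
    where
    out≡0 : ⌊ out b j ≟ 0 ⌋ ≡ true
    out≡0 = trans (sym (if-true (≡⇒==1 {tp2 (μ j)} (trans tj (sym (π-ι t)))))) (allFin-true M _ silent-b j)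

  matchedAny : Fin n → Fin n → Bool
  matchedAny a b = anyFin M (λ j → matched j a b)

  candidate : Fin n → Fin n → Bool
  candidate a b =
    if royal (tp a) then silentTo (tp a) b ∧ not ⌊ a F.≟ b ⌋
    else if royal (tp b) then true
    else inBlock (next (block a)) b ∧ not (matchedAny a b)

  candidate-royal : ∀ a b → royal (tp a) ≡ true → candidate a b ≡ true → silentTo (tp a) b ≡ true
  candidate-royal a b royal-a e = ∧-true-left (silentTo (tp a) b) (trans (sym (if-true royal-a)) e)

  candidate-commoners : ∀ a b → royal (tp a) ≡ false → royal (tp b) ≡ false → candidate a b ≡ true →
                        (inBlock (next (block a)) b ≡ true) × (matchedAny a b ≡ false)
  candidate-commoners a b common-a common-b e =
    ∧-true-left (inBlock (next (block a)) b) in-block , not-true (∧-true-right (inBlock (next (block a)) b) in-block)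
    where
    in-block : (inBlock (next (block a)) b ∧ not (matchedAny a b)) ≡ true
    in-block = trans (sym (trans (if-false common-a) (if-false common-b))) e

  royal-receives-once : ∀ t e j j′ → royal t ≡ true → 0 < out e j → 0 < out e j′ → j ≢ j′ →
                        tp2 (μ j) ≡ t → tp2 (μ j′) ≡ t → ⊥
  royal-receives-once t e j j′ royal-t pos pos′ j≢j′ tj tj′ = <-irrefl refl (begin-strict
    1                        <⟨ +-mono-≤ pos pos′ ⟩
    out e j + out e j′       ≡⟨ cong₂ _+_ (at j tj) (at j′ tj′) ⟨
    to-t j + to-t j′         ≤⟨ two-terms≤∑ M to-t j j′ j≢j′ ⟩
    s 𝓕 (ι t) (starOf e)     ≤⟨ s≤u (ι t) (starOf e) ⟩
    u t                      ≤⟨ royal⇒u≤1 t royal-t ⟩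
    1                        ∎)
    where
    open ≤-Reasoning
    to-t : Fin M → ℕ
    to-t i = if tp2 (μ i) ==1 π (ι t) then out e i else 0
    at : ∀ i → tp2 (μ i) ≡ t → to-t i ≡ out e i
    at i ti = if-true (≡⇒==1 {tp2 (μ i)} (trans ti (sym (π-ι t))))

  candidateOf : Fin n → OneType nU nB → Fin n → Bool
  candidateOf a t c = hasType t c ∧ candidate a c

  sameTarget : Fin M → Fin M → Bool
  sameTarget j j₀ = oneWayᵇ j₀ ∧ (tp2 (μ j₀) ==1 tp2 (μ j))

  offset : Fin n → Fin M → ℕ
  offset a j = ∑ M (λ j₀ → if (toℕ j₀ <ᵇ toℕ j) ∧ sameTarget j j₀ then out a j₀ else 0)

  candidateRank : Fin n → Fin M → Fin n → ℕ
  candidateRank a j = rank n (candidateOf a (tp2 (μ j)))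

  assigned : Fin n → Fin n → Fin M → Bool
  assigned a b j = oneWayᵇ j ∧ (candidateOf a (tp2 (μ j)) b ∧ inWindow (offset a j) (out a j) (candidateRank a j b))

  assigned⇒window : ∀ a b j → assigned a b j ≡ true →
                    offset a j ≤ candidateRank a j b × candidateRank a j b < offset a j + out a j
  assigned⇒window a b j e = inWindow⇒bounds (offset a j) (out a j)
    (∧-true-right (candidateOf a (tp2 (μ j)) b) (∧-true-right (oneWayᵇ j) e))

  assigned⇒ : ∀ a b j → assigned a b j ≡ true →
              (oneWayᵇ j ≡ true) × (tp2 (μ j) ≡ tp b) × (candidate a b ≡ true) × (0 < out a j)
  assigned⇒ a b j e = ∧-true-left (oneWayᵇ j) e ,
                      sym (==1⇒≡ (tp b) _ (∧-true-left (hasType (tp2 (μ j)) b) is-candidate)) ,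
                      ∧-true-right (hasType (tp2 (μ j)) b) is-candidate ,
                      window-nonempty (assigned⇒window a b j e)
    where
    is-candidate : candidateOf a (tp2 (μ j)) b ≡ true
    is-candidate = ∧-true-left (candidateOf a (tp2 (μ j)) b) (∧-true-right (oneWayᵇ j) e)
    window-nonempty : ∀ {lo x len} → lo ≤ x × x < lo + len → 0 < len
    window-nonempty {lo} {len = zero} (lo≤x , x<lo) = ⊥-elim (<⇒≱ x<lo (≤-trans (≤-reflexive (+-identityʳ lo)) lo≤x))
    window-nonempty {len = suc _} _ = s≤s z≤n

  sendsVia : Fin n → Fin n → Fin M → Bool
  sendsVia a b j = matched j a b ∨ assigned a b j

  sendsVia⇒ : ∀ a b j → sendsVia a b j ≡ true → (tp1 (μ j) ≡ tp a) × (tp2 (μ j) ≡ tp b) × (0 < out a j)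
  sendsVia⇒ a b j e = via (∨-true (matched j a b) e)
    where
    via : matched j a b ≡ true ⊎ assigned a b j ≡ true → (tp1 (μ j) ≡ tp a) × (tp2 (μ j) ≡ tp b) × (0 < out a j)
    via (inj₁ m) = let _ , pos , _ , t2 = matched⇒ j a b m in tp1-μ a j pos , t2 , pos
    via (inj₂ s) = let _ , t2 , _ , pos = assigned⇒ a b j s in tp1-μ a j pos , t2 , pos

  invᵇ-oneWayᵇ-disjoint : ∀ j j′ → invᵇ j ≡ true → oneWayᵇ j′ ≡ true → j ≢ j′
  invᵇ-oneWayᵇ-disjoint j .j inv-j one-j refl with () ← trans (sym one-j) (trans (oneWayᵇ≡not-invᵇ j) (cong not inv-j))

  matched-assigned-absurd : ∀ a b j j′ → matched j a b ≡ true → assigned a b j′ ≡ true → ⊥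
  matched-assigned-absurd a b j j′ m s =
    let inv-j , pos-a , pos-b , t2 = matched⇒ j a b m
        one-j′ , t2′ , cand , pos-a′ = assigned⇒ a b j′ s
    in bool-cases (royal (tp a))
         (λ royal-a → silentTo⇒ (tp a) b (μ⁻ j) (candidate-royal a b royal-a cand) pos-b (tp2-μ⁻ a j inv-j pos-a))
         (λ common-a → bool-cases (royal (tp b))
           (λ royal-b → royal-receives-once (tp b) a j j′ royal-b pos-a pos-a′ (invᵇ-oneWayᵇ-disjoint j j′ inv-j one-j′) t2 t2′)
           (λ common-b → false≢true (trans (sym (proj₂ (candidate-commoners a b common-a common-b cand)))
                                           (witness⇒anyFin M (λ i → matched i a b) j m))))

  offset-separated : ∀ a j j′ → toℕ j < toℕ j′ → oneWayᵇ j ≡ true → tp2 (μ j) ≡ tp2 (μ j′) →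
                     offset a j + out a j ≤ offset a j′
  offset-separated a j j′ j<j′ one-j same = begin
    offset a j + out a j                                                       ≡⟨ cong₂ _+_ (∑-cong M earlier) (if-true c-j) ⟨
    ∑ M (λ x → if (toℕ x <ᵇ toℕ j) ∧ c x then out a x else 0) + (if c j then out a j else 0) ≤⟨ ∑-prefix+term≤∑ M c (out a) j ⟩
    offset a j′                                                                ∎
    where
    open ≤-Reasoning
    c : Fin M → Bool
    c x = (toℕ x <ᵇ toℕ j′) ∧ sameTarget j′ x
    c-j : c j ≡ true
    c-j = ∧-true-intro (<⇒<ᵇ′ j<j′) (∧-true-intro one-j (≡⇒==1 same))
    earlier : ∀ x → (if (toℕ x <ᵇ toℕ j) ∧ c x then out a x else 0) ≡ (if (toℕ x <ᵇ toℕ j) ∧ sameTarget j x then out a x else 0)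
    earlier x with toℕ x <ᵇ toℕ j in x<j
    ... | false = refl
    ... | true = cong₂ (λ b t → if b ∧ (oneWayᵇ x ∧ (tp2 (μ x) ==1 t)) then out a x else 0)
                       (<⇒<ᵇ′ (<-trans (<ᵇ⇒<′ x<j) j<j′)) (sym same)

  assigned-ordered : ∀ a b j j′ → toℕ j < toℕ j′ → assigned a b j ≡ true → assigned a b j′ ≡ true → ⊥
  assigned-ordered a b j j′ j<j′ s s′ = <-irrefl refl (begin-strict
    candidateRank a j b     <⟨ proj₂ (assigned⇒window a b j s) ⟩
    offset a j + out a j    ≤⟨ offset-separated a j j′ j<j′ (proj₁ (assigned⇒ a b j s)) same ⟩
    offset a j′             ≤⟨ proj₁ (assigned⇒window a b j′ s′) ⟩
    candidateRank a j′ b    ≡⟨ cong (λ t → rank n (candidateOf a t) b) same ⟨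
    candidateRank a j b     ∎)
    where
    open ≤-Reasoning
    same : tp2 (μ j) ≡ tp2 (μ j′)
    same = trans (proj₁ (proj₂ (assigned⇒ a b j s))) (sym (proj₁ (proj₂ (assigned⇒ a b j′ s′))))

  sendsVia-unique : ∀ a b → AtMostOne (sendsVia a b)
  sendsVia-unique a b j j′ e e′ = via (∨-true (matched j a b) e) (∨-true (matched j′ a b) e′)
    where
    via : matched j a b ≡ true ⊎ assigned a b j ≡ true → matched j′ a b ≡ true ⊎ assigned a b j′ ≡ true → j ≡ j′
    via (inj₁ m) (inj₁ m′) = let inv-j , pos , _ , t2 = matched⇒ j a b m
                                 inv-j′ , pos′ , _ , t2′ = matched⇒ j′ a b m′
                             in inv-target-unique (starOf a) j j′ inv-j inv-j′ pos pos′ (trans t2 (sym t2′))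
    via (inj₁ m) (inj₂ s′) = ⊥-elim (matched-assigned-absurd a b j j′ m s′)
    via (inj₂ s) (inj₁ m′) = ⊥-elim (matched-assigned-absurd a b j′ j m′ s)
    via (inj₂ s) (inj₂ s′) = compare (<-cmp (toℕ j) (toℕ j′))
      where
      compare : Tri (toℕ j < toℕ j′) (toℕ j ≡ toℕ j′) (toℕ j′ < toℕ j) → j ≡ j′
      compare (tri< j<j′ _ _) = ⊥-elim (assigned-ordered a b j j′ j<j′ s s′)
      compare (tri≈ _ j≡j′ _) = FP.toℕ-injective j≡j′
      compare (tri> _ _ j′<j) = ⊥-elim (assigned-ordered a b j′ j j′<j s′ s)

  assigned-both-ways-absurd : ∀ a b j j″ → assigned a b j ≡ true → assigned b a j″ ≡ true → ⊥
  assigned-both-ways-absurd a b j j″ s s″ =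
    let _ , t2 , cand , pos = assigned⇒ a b j s
        _ , t2″ , cand″ , pos″ = assigned⇒ b a j″ s″
    in bool-cases (royal (tp a))
         (λ royal-a → silentTo⇒ (tp a) b j″ (candidate-royal a b royal-a cand) pos″ t2″)
         (λ common-a → bool-cases (royal (tp b))
           (λ royal-b → silentTo⇒ (tp b) a j (candidate-royal b a royal-b cand″) pos t2)
           (λ common-b → next²-irreflexive (block a) (begin
             block a                ≡⟨ inBlock⇒block (next (block b)) a (proj₁ (candidate-commoners b a common-b common-a cand″)) (next≤2 (block b)) ⟩
             next (block b)         ≡⟨ cong next (inBlock⇒block (next (block a)) b (proj₁ (candidate-commoners a b common-a common-b cand)) (next≤2 (block a))) ⟩
             next (next (block a))  ∎)))
    where open ≡-Reasoning

  sendsVia-consistent : ∀ a b j j″ → sendsVia a b j ≡ true → sendsVia b a j″ ≡ true → μ j″ ≡ inv (μ j)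
  sendsVia-consistent a b j j″ e e″ = via (∨-true (matched j a b) e) (∨-true (matched j″ b a) e″)
    where
    via : matched j a b ≡ true ⊎ assigned a b j ≡ true → matched j″ b a ≡ true ⊎ assigned b a j″ ≡ true → μ j″ ≡ inv (μ j)
    via (inj₁ m) (inj₁ m″) =
      let inv-j , pos-a , pos-b , _ = matched⇒ j a b m
          inv-j″ , pos-b″ , _ , t2″ = matched⇒ j″ b a m″
      in trans (cong μ (inv-target-unique (starOf b) j″ (μ⁻ j) inv-j″ (invᵇ-μ⁻ j inv-j) pos-b″ pos-b
                          (trans t2″ (sym (tp2-μ⁻ a j inv-j pos-a)))))
               (μ-μ⁻ j (<ᵇ⇒<′ inv-j))
    via (inj₁ m) (inj₂ s″) = ⊥-elim (matched-assigned-absurd b a (μ⁻ j) j″ (matched-sym j a b m) s″)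
    via (inj₂ s) (inj₁ m″) = ⊥-elim (matched-assigned-absurd a b (μ⁻ j″) j (matched-sym j″ b a m″) s)
    via (inj₂ s) (inj₂ s″) = ⊥-elim (assigned-both-ways-absurd a b j j″ s s″)

  sendsVia-irreflexive : ∀ a j → sendsVia a a j ≡ false
  sendsVia-irreflexive a j = bool-cases (sendsVia a a j) (λ e → ⊥-elim (via (∨-true (matched j a a) e))) id
    where
    via : matched j a a ≡ true ⊎ assigned a a j ≡ true → ⊥
    via (inj₁ m) = let inv-j , pos , _ , t2 = matched⇒ j a a m in inv-target≢own (starOf a) j inv-j pos t2
    via (inj₂ s) =
      let _ , t2 , cand , pos = assigned⇒ a a j s
      in bool-cases (royal (tp a))
           (λ royal-a → silentTo⇒ (tp a) a j (candidate-royal a a royal-a cand) pos t2)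
           (λ common → next-irreflexive (block a)
              (inBlock⇒block (next (block a)) a (proj₁ (candidate-commoners a a common common cand)) (next≤2 (block a))))

  -- Counting the messages sent

  sentTo-split : ∀ i k → s 𝓕 i k ≡ invertibleTo k (π i) + r 𝓕 i k
  sentTo-split i k = trans (∑-cong M split) (∑-distrib-+ M _ _)
    where
    split : ∀ j → (if tp2 (μ j) ==1 π i then _[_] 𝓕 k j else 0)
                ≡ (if invᵇ j ∧ (tp2 (μ j) ==1 π i) then _[_] 𝓕 k j else 0)
                  + (if oneWayᵇ j ∧ (tp2 (μ j) ==1 π i) then _[_] 𝓕 k j else 0)
    split j = trans (if-split (invᵇ j) (tp2 (μ j) ==1 π i) (_[_] 𝓕 k j))
                    (cong (λ b → (if invᵇ j ∧ (tp2 (μ j) ==1 π i) then _[_] 𝓕 k j else 0)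
                                 + (if b ∧ (tp2 (μ j) ==1 π i) then _[_] 𝓕 k j else 0))
                          (sym (oneWayᵇ≡not-invᵇ j)))

  out-total≤D : ∀ a → ∑ M (out a) ≤ D
  out-total≤D a = begin
    ∑ M (out a)                                   ≤⟨ ∑-mono-≤ M some-counting-predicate ⟩
    ∑ M (λ j → ∑ m (λ h → via h j))               ≡⟨ ∑-comm M m (λ j h → via h j) ⟩
    ∑ m (λ h → ∑ M (via h))                       ≡⟨ ∑-cong m (proj₂ (proj₂ (proj₂ models)) (starOf a)) ⟩
    ∑ m C                                         ≤⟨ ∑≤n*maxFin m C ⟩
    D                                             ∎
    where
    open ≤-Reasoning
    via : Fin m → Fin M → ℕ
    via h j = if lookup (bxy (μ j)) (f h) then out a j else 0
    some-counting-predicate : ∀ j → out a j ≤ ∑ m (λ h → via h j)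
    some-counting-predicate j = let h , fh = anyFin-witness m _ (μ-isMsg j) in
      ≤-trans (≤-reflexive (sym (if-true fh))) (term≤∑ m (λ h → via h j) h)

  s≤D : ∀ i a → s 𝓕 i (starOf a) ≤ D
  s≤D i a = ≤-trans (∑-mono-≤ M (λ j → if≤ (tp2 (μ j) ==1 π i) (out a j))) (out-total≤D a)

  o-own : ∀ a → o 𝓕 (ι (tp a)) (starOf a) ≡ 1
  o-own a = if-true (≡⇒==1 {tp a} (sym (π-ι (tp a))))

  count-silentTo : ∀ t′ t → count n (λ c → hasType t′ c ∧ silentTo t c) ≡ xₛ 𝓕 w (ι t′) (ι t)
  count-silentTo t′ t = trans (count-starOf (λ k → (tpσ 𝓕 k ==1 t′) ∧ p-test k)) (∑-cong N pointwise)
    where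
    p-test : Fin N → Bool
    p-test k = allFin M (λ j → if tp2 (μ j) ==1 π (ι t) then ⌊ _[_] 𝓕 k j ≟ 0 ⌋ else true)
    pointwise : ∀ k → w k * 𝟙 ((tpσ 𝓕 k ==1 t′) ∧ p-test k) ≡ o 𝓕 (ι t′) k * p 𝓕 (ι t) k * w k
    pointwise k = begin
      w k * 𝟙 ((tpσ 𝓕 k ==1 t′) ∧ p-test k)            ≡⟨ *-comm (w k) _ ⟩
      𝟙 ((tpσ 𝓕 k ==1 t′) ∧ p-test k) * w k            ≡⟨ cong (_* w k) (𝟙-∧ (tpσ 𝓕 k ==1 t′) (p-test k)) ⟩
      𝟙 (tpσ 𝓕 k ==1 t′) * 𝟙 (p-test k) * w k          ≡⟨ cong (λ t″ → 𝟙 (tpσ 𝓕 k ==1 t″) * 𝟙 (p-test k) * w k) (sym (π-ι t′)) ⟩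
      o 𝓕 (ι t′) k * p 𝓕 (ι t) k * w k                 ∎
      where open ≡-Reasoning

  count-candidates-royal : ∀ a t → royal (tp a) ≡ true →
    count n (candidateOf a t) + 𝟙 (hasType t a ∧ silentTo (tp a) a) ≡ xₛ 𝓕 w (ι t) (ι (tp a))
  count-candidates-royal a t royal-a = begin
    count n (candidateOf a t) + 𝟙 (P a)                    ≡⟨ cong (_+ 𝟙 (P a)) (count-cong n unfold) ⟩
    count n (λ c → P c ∧ not ⌊ a F.≟ c ⌋) + 𝟙 (P a)        ≡⟨ count-remove n P a ⟩
    count n P                                              ≡⟨ count-silentTo t (tp a) ⟩
    xₛ 𝓕 w (ι t) (ι (tp a))                                ∎
    where
    open ≡-Reasoning
    P : Fin n → Bool
    P c = hasType t c ∧ silentTo (tp a) c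
    unfold : ∀ c → candidateOf a t c ≡ (P c ∧ not ⌊ a F.≟ c ⌋)
    unfold c = trans (cong (hasType t c ∧_) (if-true royal-a)) (sym (∧-assoc (hasType t c) _ _))

  candidates-royal-sender : ∀ a t → royal (tp a) ≡ true → r 𝓕 (ι t) (starOf a) ≤ count n (candidateOf a t)
  candidates-royal-sender a t royal-a = bool-cases (hasType t a ∧ silentTo (tp a) a) silent-to-itself silent-elsewhere
    where
    r≤x : r 𝓕 (ι t) (starOf a) ≤ xₛ 𝓕 w (ι t) (ι (tp a))
    r≤x = [ (λ 1<u → ⊥-elim (<⇒≱ 1<u (royal⇒u≤1 (tp a) royal-a))) , id ]′ (royal-room (ι (tp a)) (ι t) (starOf a) (o-own a))
    silent-elsewhere : (hasType t a ∧ silentTo (tp a) a) ≡ false → r 𝓕 (ι t) (starOf a) ≤ count n (candidateOf a t)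
    silent-elsewhere not-P = ≤-trans r≤x (≤-reflexive (trans (sym (count-candidates-royal a t royal-a))
                                                         (trans (cong (λ b → count n (candidateOf a t) + 𝟙 b) not-P) (+-identityʳ _))))
    silent-to-itself : (hasType t a ∧ silentTo (tp a) a) ≡ true → r 𝓕 (ι t) (starOf a) ≤ count n (candidateOf a t)
    silent-to-itself P-a = ≤-trans (≤-reflexive (∑-zero M (λ j → if-zero _ (out a j) (nothing-to j)))) z≤n
      where
      nothing-to : ∀ j → (oneWayᵇ j ∧ (tp2 (μ j) ==1 π (ι t))) ≡ true → out a j ≡ 0
      nothing-to j to-t = n≤0⇒n≡0 (≮⇒≥ (λ pos → silentTo⇒ (tp a) a j (∧-true-right (hasType t a) P-a) pos
        (trans (==1⇒≡ _ _ (∧-true-right (oneWayᵇ j) to-t))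
               (trans (π-ι t) (sym (==1⇒≡ (tp a) t (∧-true-left (hasType t a) P-a)))))))

  hasType⇒candidate : ∀ a t c → royal (tp a) ≡ false → royal t ≡ true → hasType t c ≡ candidateOf a t c
  hasType⇒candidate a t c common-a royal-t = bool-cases (hasType t c)
    (λ t-c → trans t-c (sym (trans (cong (_∧ candidate a c) t-c)
               (trans (if-false common-a) (if-true (trans (cong royal (==1⇒≡ (tp c) t t-c)) royal-t))))))
    (λ ¬t-c → trans ¬t-c (sym (cong (_∧ candidate a c) ¬t-c)))

  candidates-royal-target : ∀ a t → royal (tp a) ≡ false → royal t ≡ true → r 𝓕 (ι t) (starOf a) ≤ count n (candidateOf a t)
  candidates-royal-target a t common-a royal-t = begin
    r 𝓕 (ι t) (starOf a)                          ≤⟨ m≤n+m _ _ ⟩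
    invertibleTo (starOf a) (π (ι t)) + r 𝓕 (ι t) (starOf a) ≡⟨ sentTo-split (ι t) (starOf a) ⟨
    s 𝓕 (ι t) (starOf a)                          ≤⟨ s≤u (ι t) (starOf a) ⟩
    u t                                           ≡⟨ count-hasType t ⟨
    count n (hasType t)                           ≡⟨ count-cong n (λ c → hasType⇒candidate a t c common-a royal-t) ⟩
    count n (candidateOf a t)                     ∎
    where open ≤-Reasoning

  count-block : ∀ t g → royal t ≡ false → g ≤ 2 → count n (λ c → hasType t c ∧ inBlock g c) ≡ D
  count-block t g common-t g≤2 =
    trans (count-cong n at-rank) (count-rank-window n (hasType t) (g * D) D (begin
      g * D + D              ≡⟨ +-comm (g * D) D ⟩
      suc g * D              ≤⟨ *-monoˡ-≤ D (s≤s g≤2) ⟩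
      3 * D                  ≤⟨ nonroyal⇒3D≤u t common-t ⟩
      u t                    ≡⟨ count-hasType t ⟨
      count n (hasType t)    ∎))
    where
    open ≤-Reasoning
    at-rank : ∀ c → (hasType t c ∧ inBlock g c) ≡ (hasType t c ∧ inWindow (g * D) D (rank n (hasType t) c))
    at-rank c = bool-cases (hasType t c)
      (λ t-c → cong (λ t′ → hasType t c ∧ inWindow (g * D) D (rank n (hasType t′) c)) (==1⇒≡ (tp c) t t-c))
      (λ ¬t-c → trans (cong (_∧ inBlock g c) ¬t-c) (sym (cong (_∧ inWindow (g * D) D (rank n (hasType t) c)) ¬t-c)))

  count-matched-to : ∀ a t → count n (λ c → hasType t c ∧ matchedAny a c) ≤ invertibleTo (starOf a) t
  count-matched-to a t = begin
    count n (λ c → hasType t c ∧ matchedAny a c)                  ≤⟨ ∑-mono-≤ n any≤∑ ⟩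
    ∑ n (λ c → ∑ M (λ j → 𝟙 (hasType t c ∧ matched j a c)))       ≡⟨ ∑-comm n M (λ c j → 𝟙 (hasType t c ∧ matched j a c)) ⟩
    ∑ M (λ j → count n (λ c → hasType t c ∧ matched j a c))       ≤⟨ ∑-mono-≤ M per-message ⟩
    invertibleTo (starOf a) t                                           ∎
    where
    open ≤-Reasoning
    any≤∑ : ∀ c → 𝟙 (hasType t c ∧ matchedAny a c) ≤ ∑ M (λ j → 𝟙 (hasType t c ∧ matched j a c))
    any≤∑ c = bool-cases (hasType t c)
      (λ t-c → subst (λ b → 𝟙 (b ∧ matchedAny a c) ≤ ∑ M (λ j → 𝟙 (b ∧ matched j a c))) (sym t-c)
                 (𝟙-anyFin≤∑ M (λ j → matched j a c)))
      (λ ¬t-c → subst (λ b → 𝟙 (b ∧ matchedAny a c) ≤ ∑ M (λ j → 𝟙 (b ∧ matched j a c))) (sym ¬t-c) z≤n)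
    per-message : ∀ j → count n (λ c → hasType t c ∧ matched j a c)
                        ≤ (if invᵇ j ∧ (tp2 (μ j) ==1 t) then out a j else 0)
    per-message j = bool-cases (invᵇ j ∧ (tp2 (μ j) ==1 t))
      (λ to-t → subst (count n (λ c → hasType t c ∧ matched j a c) ≤_) (sym (if-true to-t))
         (≤-trans (count-mono n {q = matched j a} (λ c → ∧-true-right (hasType t c)))
                  (≤-reflexive (count-matched a j (∧-true-left (invᵇ j) to-t)))))
      (λ ¬to-t → ≤-reflexive (trans (count-zero n (elsewhere ¬to-t)) (sym (if-false ¬to-t))))
      where
      elsewhere : (invᵇ j ∧ (tp2 (μ j) ==1 t)) ≡ false → ∀ c → (hasType t c ∧ matched j a c) ≡ false
      elsewhere ¬to-t c = bool-cases (hasType t c ∧ matched j a c) (λ e → ⊥-elim (false≢true (trans (sym ¬to-t) (to-t e)))) id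
        where
        to-t : (hasType t c ∧ matched j a c) ≡ true → (invᵇ j ∧ (tp2 (μ j) ==1 t)) ≡ true
        to-t e = let inv-j , _ , _ , t2 = matched⇒ j a c (∧-true-right (hasType t c) e) in
                 ∧-true-intro inv-j (≡⇒==1 {tp2 (μ j)} (trans t2 (==1⇒≡ (tp c) t (∧-true-left (hasType t c) e))))

  candidates-commoners : ∀ a t → royal (tp a) ≡ false → royal t ≡ false → r 𝓕 (ι t) (starOf a) ≤ count n (candidateOf a t)
  candidates-commoners a t common-a common-t = +-cancelˡ-≤ (invertibleTo (starOf a) t) _ _ (begin
    invertibleTo (starOf a) t + r 𝓕 (ι t) (starOf a)           ≡⟨ cong (λ t′ → invertibleTo (starOf a) t′ + r 𝓕 (ι t) (starOf a)) (π-ι t) ⟨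
    invertibleTo (starOf a) (π (ι t)) + r 𝓕 (ι t) (starOf a)   ≡⟨ sentTo-split (ι t) (starOf a) ⟨
    s 𝓕 (ι t) (starOf a)                                 ≤⟨ s≤D (ι t) a ⟩
    D                                                    ≡⟨ count-block t g common-t (next≤2 (block a)) ⟨
    count n H                                            ≡⟨ count-split n H (matchedAny a) ⟩
    count n (λ c → H c ∧ matchedAny a c) + count n (λ c → H c ∧ not (matchedAny a c))
                                                         ≤⟨ +-mono-≤ matched-in-block (≤-reflexive (count-cong n unmatched-in-block)) ⟩
    invertibleTo (starOf a) t + count n (candidateOf a t)      ∎)
    where
    open ≤-Reasoning
    g : ℕ
    g = next (block a)
    H : Fin n → Bool
    H c = hasType t c ∧ inBlock g c
    matched-in-block : count n (λ c → H c ∧ matchedAny a c) ≤ invertibleTo (starOf a) t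
    matched-in-block = ≤-trans (count-mono n {q = λ c → hasType t c ∧ matchedAny a c} weaken) (count-matched-to a t)
      where
      weaken : ∀ c → (H c ∧ matchedAny a c) ≡ true → (hasType t c ∧ matchedAny a c) ≡ true
      weaken c e = ∧-true-intro (∧-true-left (hasType t c) (∧-true-left (H c) e)) (∧-true-right (H c) e)
    unmatched-in-block : ∀ c → (H c ∧ not (matchedAny a c)) ≡ candidateOf a t c
    unmatched-in-block c = bool-cases (hasType t c)
      (λ t-c → trans (cong (λ b → (b ∧ inBlock g c) ∧ not (matchedAny a c)) t-c)
        (sym (trans (cong (_∧ candidate a c) t-c)
          (trans (if-false common-a) (if-false (trans (cong royal (==1⇒≡ (tp c) t t-c)) common-t))))))
      (λ ¬t-c → trans (cong (λ b → (b ∧ inBlock g c) ∧ not (matchedAny a c)) ¬t-c) (sym (cong (_∧ candidate a c) ¬t-c)))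

  enough-candidates : ∀ a t → r 𝓕 (ι t) (starOf a) ≤ count n (candidateOf a t)
  enough-candidates a t = bool-cases (royal (tp a)) (candidates-royal-sender a t)
    λ common-a → bool-cases (royal t) (candidates-royal-target a t common-a) (candidates-commoners a t common-a)

  offset+out≤r : ∀ a j → oneWayᵇ j ≡ true → offset a j + out a j ≤ r 𝓕 (ι (tp2 (μ j))) (starOf a)
  offset+out≤r a j one-j = begin
    offset a j + out a j                                  ≡⟨ cong (offset a j +_) (if-true c-j) ⟨
    offset a j + (if sameTarget j j then out a j else 0)  ≤⟨ ∑-prefix+term≤∑ M (sameTarget j) (out a) j ⟩
    ∑ M (λ x → if sameTarget j x then out a x else 0)     ≡⟨ ∑-cong M (λ x → cong (λ t → if oneWayᵇ x ∧ (tp2 (μ x) ==1 t) then out a x else 0)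
                                                                                  (sym (π-ι (tp2 (μ j))))) ⟩
    r 𝓕 (ι (tp2 (μ j))) (starOf a)                        ∎
    where
    open ≤-Reasoning
    c-j : sameTarget j j ≡ true
    c-j = ∧-true-intro one-j (≡⇒==1 {tp2 (μ j)} refl)

  count-assigned : ∀ a j → count n (λ b → assigned a b j) ≡ (if oneWayᵇ j then out a j else 0)
  count-assigned a j = bool-cases (oneWayᵇ j) one-way
    (λ two-way → trans (count-zero n (λ b → cong (_∧ window b) two-way)) (sym (if-false two-way)))
    where
    P : Fin n → Bool
    P = candidateOf a (tp2 (μ j))
    window : Fin n → Bool
    window b = P b ∧ inWindow (offset a j) (out a j) (candidateRank a j b)
    one-way : oneWayᵇ j ≡ true → count n (λ b → assigned a b j) ≡ (if oneWayᵇ j then out a j else 0)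
    one-way one-j = trans (count-cong n (λ b → cong (_∧ window b) one-j))
      (trans (count-rank-window n P (offset a j) (out a j) (≤-trans (offset+out≤r a j one-j) (enough-candidates a (tp2 (μ j)))))
             (sym (if-true one-j)))

  count-sendsVia : ∀ a j → count n (λ b → sendsVia a b j) ≡ out a j
  count-sendsVia a j = bool-cases (invᵇ j) invertible-j one-way-j
    where
    one-way≡not : oneWayᵇ j ≡ not (invᵇ j)
    one-way≡not = oneWayᵇ≡not-invᵇ j
    invertible-j : invᵇ j ≡ true → count n (λ b → sendsVia a b j) ≡ out a j
    invertible-j inv-j = trans (count-cong n (λ b → trans (cong (matched j a b ∨_) (no-assignment b)) (∨-identityʳ _)))
                               (count-matched a j inv-j)
      where
      no-assignment : ∀ b → assigned a b j ≡ false
      no-assignment b = cong (_∧ (candidateOf a (tp2 (μ j)) b ∧ inWindow (offset a j) (out a j) (candidateRank a j b)))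
                             (trans one-way≡not (cong not inv-j))
    one-way-j : invᵇ j ≡ false → count n (λ b → sendsVia a b j) ≡ out a j
    one-way-j inv-j = trans (count-cong n (λ b → cong (_∨ assigned a b j) (matched-invᵇ j a b inv-j)))
                            (trans (count-assigned a j) (if-true (trans one-way≡not (cong not inv-j))))

  message : Fin n → Fin n → Maybe (Fin M)
  message a b = first M (sendsVia a b)

  message-is : ∀ a b j → message a b is j ≡ sendsVia a b j
  message-is a b = first-is M (sendsVia a b) (sendsVia-unique a b)

  message-self : ∀ a → message a a ≡ nothing
  message-self a = first-none M (sendsVia a a) (sendsVia-irreflexive a)

  message-just : ∀ a b j → message a b ≡ just j → sendsVia a b j ≡ true
  message-just a b = first-just M (sendsVia a b)

  message-nothing : ∀ a b j → message a b ≡ nothing → sendsVia a b j ≡ false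
  message-nothing a b j e = first-nothing M (sendsVia a b) e j

  -- Silent pairs and the 2-types of the structure

  assignedTo : Fin n → OneType nU nB → Fin n → Bool
  assignedTo a t c = anyFin M (λ j → assigned a c j ∧ (tp2 (μ j) ==1 t))

  count-assignedTo : ∀ a t → count n (assignedTo a t) ≡ r 𝓕 (ι t) (starOf a)
  count-assignedTo a t = begin
    count n (assignedTo a t)                                            ≡⟨ ∑-cong n (λ c → 𝟙-anyFin≡∑ M (assignment c) (unique c)) ⟩
    ∑ n (λ c → ∑ M (λ j → 𝟙 (assignment c j)))                          ≡⟨ ∑-comm n M (λ c j → 𝟙 (assignment c j)) ⟩
    ∑ M (λ j → count n (λ c → assignment c j))                          ≡⟨ ∑-cong M per-message ⟩
    r 𝓕 (ι t) (starOf a)                                                ∎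
    where
    open ≡-Reasoning
    assignment : Fin n → Fin M → Bool
    assignment c j = assigned a c j ∧ (tp2 (μ j) ==1 t)
    unique : ∀ c → AtMostOne (assignment c)
    unique c j j′ e e′ = sendsVia-unique a c j j′ (via e) (via e′)
      where
      via : ∀ {i} → assignment c i ≡ true → sendsVia a c i ≡ true
      via {i} e = trans (cong (matched i a c ∨_) (∧-true-left (assigned a c i) e)) (∨-zeroʳ _)
    per-message : ∀ j → count n (λ c → assignment c j) ≡ (if oneWayᵇ j ∧ (tp2 (μ j) ==1 π (ι t)) then out a j else 0)
    per-message j = begin
      count n (λ c → assignment c j)                                     ≡⟨ count-∧-const n (λ c → assigned a c j) _ ⟩
      (if tp2 (μ j) ==1 t then count n (λ c → assigned a c j) else 0)    ≡⟨ cong (λ x → if tp2 (μ j) ==1 t then x else 0) (count-assigned a j) ⟩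
      (if tp2 (μ j) ==1 t then (if oneWayᵇ j then out a j else 0) else 0) ≡⟨ if-if (tp2 (μ j) ==1 t) (oneWayᵇ j) (out a j) ⟩
      (if oneWayᵇ j ∧ (tp2 (μ j) ==1 t) then out a j else 0)             ≡⟨ cong (λ t′ → if oneWayᵇ j ∧ (tp2 (μ j) ==1 t′) then out a j else 0) (π-ι t) ⟨
      (if oneWayᵇ j ∧ (tp2 (μ j) ==1 π (ι t)) then out a j else 0)       ∎

  assignedTo⇒candidate : ∀ a t c → assignedTo a t c ≡ true → candidateOf a t c ≡ true
  assignedTo⇒candidate a t c e =
    let j , e′ = anyFin-witness M (λ j → assigned a c j ∧ (tp2 (μ j) ==1 t)) e
        s = ∧-true-left (assigned a c j) e′
    in subst (λ t′ → candidateOf a t′ c ≡ true) (==1⇒≡ _ t (∧-true-right (assigned a c j) e′))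
             (∧-true-left (candidateOf a (tp2 (μ j)) c) (∧-true-right (oneWayᵇ j) s))

  silent-towards-royal : ∀ a b → royal (tp a) ≡ true → message b a ≡ nothing → silentTo (tp a) b ≡ true
  silent-towards-royal a b royal-a b↛a = bool-cases (silentTo (tp a) b) id λ e →
    let j , e′ = allFin-counterexample M _ e in
    bool-cases (tp2 (μ j) ==1 π (ι (tp a)))
      (λ to-a → let c , sends-c = count-pos⇒witness n (λ c → sendsVia b c j)
                      (subst (0 <_) (sym (count-sendsVia b j)) (n≢0⇒n>0 (λ out≡0 →
                        false≢true (trans (sym e′) (trans (if-true to-a) (cong (λ x → ⌊ x ≟ 0 ⌋) out≡0))))))
                    tp-c = trans (sym (proj₁ (proj₂ (sendsVia⇒ b c j sends-c))))
                                 (trans (==1⇒≡ _ _ to-a) (π-ι (tp a)))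
                in ⊥-elim (false≢true (trans (sym (message-nothing b a j b↛a))
                                             (subst (λ x → sendsVia b x j ≡ true) (royal-unique (tp a) c a royal-a tp-c refl) sends-c))))
      (λ not-to-a → ⊥-elim (false≢true (trans (sym e′) (if-false not-to-a))))

  silent-pair-royal : ∀ a b → a ≢ b → royal (tp a) ≡ true → message a b ≡ nothing → message b a ≡ nothing →
                      inI 𝓕 (ι (tp a)) (ι (tp b)) ≡ true
  silent-pair-royal a b a≢b royal-a a↛b b↛a = bool-cases (inI 𝓕 (ι (tp a)) (ι (tp b))) id λ not-in-I →
    [ (λ 1<u → ⊥-elim (<⇒≱ 1<u (royal⇒u≤1 (tp a) royal-a)))
    , (λ x≤r → ⊥-elim (<-irrefl refl (begin-strict
        count n (assignedTo a t)                                <⟨ count-<-superset n b (assignedTo⇒candidate a t) b-candidate b-unassigned ⟩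
        count n (candidateOf a t)                               ≤⟨ m≤m+n _ _ ⟩
        count n (candidateOf a t) + 𝟙 (hasType t a ∧ silentTo (tp a) a) ≡⟨ count-candidates-royal a t royal-a ⟩
        xₛ 𝓕 w (ι t) (ι (tp a))                                  ≤⟨ x≤r ⟩
        r 𝓕 (ι t) (starOf a)                                     ≡⟨ count-assignedTo a t ⟨
        count n (assignedTo a t)                                ∎)))
    ]′ (royal-room-tight (ι (tp a)) (ι t) (starOf a) not-in-I (o-own a))
    where
    open ≤-Reasoning
    t : OneType nU nB
    t = tp b
    b-candidate : candidateOf a t b ≡ true
    b-candidate = ∧-true-intro (≡⇒==1 {tp b} refl) (trans (if-true royal-a)
      (∧-true-intro (silent-towards-royal a b royal-a b↛a) (cong not (≢⇒⌊≟⌋≡false a≢b))))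
    b-unassigned : assignedTo a t b ≡ false
    b-unassigned = bool-cases (assignedTo a t b) (λ e →
      let j , e′ = anyFin-witness M _ e in
      ⊥-elim (false≢true (trans (sym (message-nothing a b j a↛b))
                                (trans (cong (matched j a b ∨_) (∧-true-left (assigned a b j) e′)) (∨-zeroʳ _))))) id

  inI-sym : ∀ i i′ → inI 𝓕 i i′ ≡ inI 𝓕 i′ i
  inI-sym i i′ = compare (<-cmp (toℕ i) (toℕ i′))
    where
    ordered : ∀ i i′ → toℕ i < toℕ i′ → inI 𝓕 i i′ ≡ inI 𝓕 i′ i
    ordered i i′ i<i′ = trans (if-true (≤⇒≤ᵇ′ (<⇒≤ i<i′))) (sym (if-false (≰⇒≤ᵇ≡false (<⇒≱ i<i′))))
    compare : Tri (toℕ i < toℕ i′) (toℕ i ≡ toℕ i′) (toℕ i′ < toℕ i) → inI 𝓕 i i′ ≡ inI 𝓕 i′ i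
    compare (tri< i<i′ _ _) = ordered i i′ i<i′
    compare (tri≈ _ i≡i′ _) = subst (λ x → inI 𝓕 i x ≡ inI 𝓕 x i) (FP.toℕ-injective i≡i′) refl
    compare (tri> _ _ i′<i) = sym (ordered i′ i i′<i)

  silent-pair : ∀ a b → a ≢ b → message a b ≡ nothing → message b a ≡ nothing → inI 𝓕 (ι (tp a)) (ι (tp b)) ≡ true
  silent-pair a b a≢b a↛b b↛a = bool-cases (royal (tp a)) (λ royal-a → silent-pair-royal a b a≢b royal-a a↛b b↛a)
    λ common-a → bool-cases (royal (tp b))
      (λ royal-b → trans (inI-sym _ _) (silent-pair-royal b a (a≢b ∘ sym) royal-b b↛a a↛b))
      (λ common-b → bool-cases (inI 𝓕 (ι (tp a)) (ι (tp b))) id λ not-in-I →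
        ⊥-elim ([ (λ u≤1 → false≢true (trans (sym common-a) (≤⇒≤ᵇ′ u≤1)))
                , (λ u≤1 → false≢true (trans (sym common-b) (≤⇒≤ᵇ′ u≤1))) ]′ (commoners-in-I _ _ not-in-I)))

  AllowedSilent : TwoType nU nB → OneType nU nB → OneType nU nB → Set
  AllowedSilent τ t t′ = (tp1 τ ≡ t) × (tp2 τ ≡ t′) × (eval2 β τ ≡ true) × (eval2 β (inv τ) ≡ true)
                         × (isMsg τ ≡ false) × (isMsg (inv τ) ≡ false)

  AllowedSilent-inv : ∀ τ t t′ → AllowedSilent τ t t′ → AllowedSilent (inv τ) t′ t
  AllowedSilent-inv τ t t′ (t1 , t2 , βτ , βτ⁻ , silent-τ , silent-τ⁻) = t2 , t1 , βτ⁻ , βτ , silent-τ⁻ , silent-τ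

  θ-allowed : ∀ i i′ τ → toℕ i ≤ toℕ i′ → θ i i′ ≡ just τ → AllowedSilent τ (π i) (π i′)
  θ-allowed i i′ τ i≤i′ e =
    let silent-τ , t1 , t2 = θ-ok i i′ τ i≤i′ e
        βτ , βτ⁻ = proj₁ (proj₂ (proj₂ models)) i i′ τ i≤i′ e
    in t1 , t2 , βτ , βτ⁻ , not-true (∧-true-left (not (isMsg τ)) silent-τ) , not-true (∧-true-right (not (isMsg τ)) silent-τ)

  -- A fixed 2-type, used where θ is undefined; it is never reached since silent pairs are in I.
  filler : TwoType nU nB
  filler = mk2 (V.replicate nU false) (V.replicate nU false) (V.replicate nB false)
               (V.replicate nB false) (V.replicate nB false) (V.replicate nB false)

  silentType : Fin Lₜ → Fin Lₜ → TwoType nU nB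
  silentType i i′ = if toℕ i ≤ᵇ toℕ i′ then fromMaybe filler (θ i i′) else inv (fromMaybe filler (θ i′ i))

  silentType-allowed : ∀ i i′ → inI 𝓕 i i′ ≡ true → AllowedSilent (silentType i i′) (π i) (π i′)
  silentType-allowed i i′ in-I = bool-cases (toℕ i ≤ᵇ toℕ i′) ordered reversed
    where
    ordered : (toℕ i ≤ᵇ toℕ i′) ≡ true → AllowedSilent (silentType i i′) (π i) (π i′)
    ordered i≤i′ = lookup-θ (θ i i′) refl
      where
      lookup-θ : ∀ x → θ i i′ ≡ x → AllowedSilent (silentType i i′) (π i) (π i′)
      lookup-θ (just τ) e = subst (λ σ′ → AllowedSilent σ′ (π i) (π i′)) (sym (trans (if-true i≤i′) (cong (fromMaybe filler) e)))
                                  (θ-allowed i i′ τ (≤ᵇ⇒≤′ i≤i′) e)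
      lookup-θ nothing e = ⊥-elim (false≢true (trans (sym (cong is-just e)) (trans (sym (if-true i≤i′)) in-I)))
    reversed : (toℕ i ≤ᵇ toℕ i′) ≡ false → AllowedSilent (silentType i i′) (π i) (π i′)
    reversed i>i′ = lookup-θ (θ i′ i) refl
      where
      lookup-θ : ∀ x → θ i′ i ≡ x → AllowedSilent (silentType i i′) (π i) (π i′)
      lookup-θ (just τ) e = subst (λ σ′ → AllowedSilent σ′ (π i) (π i′)) (sym (trans (if-false i>i′) (cong (inv ∘ fromMaybe filler) e)))
                                  (AllowedSilent-inv τ (π i′) (π i) (θ-allowed i′ i τ (<⇒≤ (≤ᵇ≡false⇒> i>i′)) e))
      lookup-θ nothing e = ⊥-elim (false≢true (trans (sym (cong is-just e)) (trans (sym (if-false i>i′)) in-I)))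

  -- Between two elements of the same 1-type θ need not be symmetric, so the orientation follows the elements.
  pairSilent : Fin n → Fin n → TwoType nU nB
  pairSilent a b = if toℕ a <ᵇ toℕ b then silentType (ι (tp a)) (ι (tp b)) else inv (silentType (ι (tp b)) (ι (tp a)))

  pairSilent-allowed : ∀ a b → a ≢ b → message a b ≡ nothing → message b a ≡ nothing → AllowedSilent (pairSilent a b) (tp a) (tp b)
  pairSilent-allowed a b a≢b a↛b b↛a = bool-cases (toℕ a <ᵇ toℕ b)
    (λ a<b → subst (λ τ → AllowedSilent τ (tp a) (tp b)) (sym (if-true a<b))
       (subst₂ (AllowedSilent (silentType (ι (tp a)) (ι (tp b)))) (π-ι (tp a)) (π-ι (tp b))
          (silentType-allowed _ _ (silent-pair a b a≢b a↛b b↛a))))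
    (λ a≮b → subst (λ τ → AllowedSilent τ (tp a) (tp b)) (sym (if-false a≮b))
       (AllowedSilent-inv _ (tp b) (tp a) (subst₂ (AllowedSilent (silentType (ι (tp b)) (ι (tp a)))) (π-ι (tp b)) (π-ι (tp a))
          (silentType-allowed _ _ (silent-pair b a (a≢b ∘ sym) b↛a a↛b)))))

  pairSilent-sym : ∀ a b → a ≢ b → pairSilent b a ≡ inv (pairSilent a b)
  pairSilent-sym a b a≢b = bool-cases (toℕ a <ᵇ toℕ b)
    (λ a<b → trans (if-false {c = toℕ b <ᵇ toℕ a} (≮⇒<ᵇ≡false (<⇒≯ (<ᵇ⇒<′ {toℕ a} a<b)))) (cong inv (sym (if-true a<b))))
    (λ a≮b → trans (if-true {c = toℕ b <ᵇ toℕ a} (<⇒<ᵇ′ (≤∧≢⇒< (<ᵇ≡false⇒≥ {toℕ a} a≮b) (a≢b ∘ sym ∘ FP.toℕ-injective)))) (cong inv (sym (if-false a≮b))))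

  edgeType : Maybe (Fin M) → Maybe (Fin M) → TwoType nU nB → TwoType nU nB
  edgeType (just j) _        _ = μ j
  edgeType nothing  (just j) _ = inv (μ j)
  edgeType nothing  nothing  τ = τ

  edge : Fin n → Fin n → TwoType nU nB
  edge a b = edgeType (message a b) (message b a) (pairSilent a b)

  edge-sym : ∀ a b → a ≢ b → edge b a ≡ inv (edge a b)
  edge-sym a b a≢b = by (message a b) (message b a) refl refl
    where
    by : ∀ x y → message a b ≡ x → message b a ≡ y → edgeType y x (pairSilent b a) ≡ inv (edgeType x y (pairSilent a b))
    by (just j) (just j″) e e″ = sendsVia-consistent a b j j″ (message-just a b j e) (message-just b a j″ e″)
    by (just j) nothing   _ _  = refl
    by nothing  (just j″) _ _  = refl
    by nothing  nothing   _ _  = pairSilent-sym a b a≢b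

  edge-fits : ∀ a b → a ≢ b → (tp1 (edge a b) ≡ tp a) × (tp2 (edge a b) ≡ tp b) × (eval2 β (edge a b) ≡ true)
  edge-fits a b a≢b = by (message a b) (message b a) refl refl
    where
    by : ∀ x y → message a b ≡ x → message b a ≡ y →
         (tp1 (edgeType x y (pairSilent a b)) ≡ tp a) × (tp2 (edgeType x y (pairSilent a b)) ≡ tp b) × (eval2 β (edgeType x y (pairSilent a b)) ≡ true)
    by (just j) _ e _ = let t1 , t2 , pos = sendsVia⇒ a b j (message-just a b j e) in
                        t1 , t2 , proj₁ (proj₁ (proj₂ models) (starOf a) j pos)
    by nothing (just j) _ e″ = let t1 , t2 , pos = sendsVia⇒ b a j (message-just b a j e″) in
                               t2 , t1 , proj₂ (proj₁ (proj₂ models) (starOf b) j pos)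
    by nothing nothing e e″ = let t1 , t2 , βτ , _ = pairSilent-allowed a b a≢b e e″ in t1 , t2 , βτ

  carries : Fin m → Maybe (Fin M) → Bool
  carries h (just j) = lookup (bxy (μ j)) (f h)
  carries h nothing  = false

  edge-carries : ∀ a b h → a ≢ b → lookup (bxy (edge a b)) (f h) ≡ carries h (message a b)
  edge-carries a b h a≢b = by (message a b) (message b a) refl refl
    where
    by : ∀ x y → message a b ≡ x → message b a ≡ y → lookup (bxy (edgeType x y (pairSilent a b))) (f h) ≡ carries h x
    by (just j) _        _   _  = refl
    by nothing  (just j) a↛b e″ = anyFin-false m _ (bool-cases (invᵇ j) invertible-j (inv-μ-silent j ∘ <ᵇ≡false⇒≥)) h
      where
      invertible-j : invᵇ j ≡ true → isMsg (inv (μ j)) ≡ false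
      invertible-j inv-j = ⊥-elim (false≢true (trans (sym (message-nothing a b (μ⁻ j) a↛b))
        (trans (cong (_∨ assigned a b (μ⁻ j)) (matched-sym j b a matched-ba)) refl)))
        where
        matched-ba : matched j b a ≡ true
        matched-ba = [ id , (λ s → ⊥-elim (false≢true (trans (sym (trans (oneWayᵇ≡not-invᵇ j) (cong not inv-j))) (∧-true-left (oneWayᵇ j) s)))) ]′
                       (∨-true (matched j b a) (message-just b a j e″))
    by nothing  nothing  e   e″ = let _ , _ , _ , _ , silent-τ , _ = pairSilent-allowed a b a≢b e e″ in anyFin-false m _ silent-τ h

  𝔄 : Structure nU nB
  𝔄 = record
    { size = size
    ; U    = λ P a → lookup (proj₁ (tp a)) P
    ; B    = λ Q a b → if ⌊ a F.≟ b ⌋ then lookup (proj₂ (tp a)) Q else lookup (bxy (edge a b)) Q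
    }

  B-self : ∀ Q a → Structure.B 𝔄 Q a a ≡ lookup (proj₂ (tp a)) Q
  B-self Q a = if-true (⌊≟⌋-refl a)

  B-other : ∀ Q a b → a ≢ b → Structure.B 𝔄 Q a b ≡ lookup (bxy (edge a b)) Q
  B-other Q a b a≢b = if-false (≢⇒⌊≟⌋≡false a≢b)

  𝔄⊨α : ∀ a → evalS 𝔄 α (λ _ → a) ≡ true
  𝔄⊨α a = trans (eval-cong (λ _ _ → refl) (λ Q _ _ → B-self Q a) α) (proj₁ models (starOf a))

  𝔄⊨β-distinct : ∀ a b → a ≢ b → evalS 𝔄 β (asg2 𝔄 a b) ≡ true

  𝔄⊨β : ∀ a b → evalS 𝔄 β (asg2 𝔄 a b) ≡ true ⊎ a ≡ b
  𝔄⊨β a b = [ inj₂ , (λ a≢b → inj₁ (𝔄⊨β-distinct a b a≢b)) ]′ (toSum (a F.≟ b))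

  𝔄⊨β-distinct a b a≢b = trans (eval-cong₂
          (λ P → cong (λ t → lookup (proj₁ t) P) (sym t1))
          (λ P → cong (λ t → lookup (proj₁ t) P) (sym t2))
          (λ Q → trans (B-self Q a) (cong (λ t → lookup (proj₂ t) Q) (sym t1)))
          (λ Q → B-other Q a b a≢b)
          (λ Q → trans (B-other Q b a (a≢b ∘ sym)) (cong (λ τ → lookup (bxy τ) Q) (edge-sym a b a≢b)))
          (λ Q → trans (B-self Q b) (cong (λ t → lookup (proj₂ t) Q) (sym t2))) β) β-edge
    where
    t1 : tp1 (edge a b) ≡ tp a
    t1 = proj₁ (edge-fits a b a≢b)
    t2 : tp2 (edge a b) ≡ tp b
    t2 = proj₁ (proj₂ (edge-fits a b a≢b))
    β-edge : eval2 β (edge a b) ≡ true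
    β-edge = proj₂ (proj₂ (edge-fits a b a≢b))

  B-carries : ∀ h a b → (Structure.B 𝔄 (f h) a b ∧ not ⌊ a F.≟ b ⌋) ≡ carries h (message a b)
  B-carries h a b = [ equal , apart ]′ (toSum (a F.≟ b))
    where
    equal : a ≡ b → (Structure.B 𝔄 (f h) a b ∧ not ⌊ a F.≟ b ⌋) ≡ carries h (message a b)
    equal refl = trans (cong (λ d → Structure.B 𝔄 (f h) a a ∧ not d) (⌊≟⌋-refl a))
                      (trans (∧-zeroʳ _) (cong (carries h) (sym (message-self a))))
    apart : a ≢ b → (Structure.B 𝔄 (f h) a b ∧ not ⌊ a F.≟ b ⌋) ≡ carries h (message a b)
    apart a≢b = trans (cong₂ (λ x d → x ∧ not d) (B-other (f h) a b a≢b) (≢⇒⌊≟⌋≡false a≢b))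
                         (trans (∧-identityʳ _) (edge-carries a b h a≢b))

  𝟙-carries : ∀ h x → 𝟙 (carries h x) ≡ ∑ M (λ j → if lookup (bxy (μ j)) (f h) then 𝟙 (x is j) else 0)
  𝟙-carries h nothing   = sym (∑-zero M (λ j → if-0 (lookup (bxy (μ j)) (f h))))
  𝟙-carries h (just j′) = sym (trans (∑-cong M single) (∑-single M j′ (𝟙 (lookup (bxy (μ j′)) (f h)))))
    where
    single : ∀ j → (if lookup (bxy (μ j)) (f h) then 𝟙 ⌊ j′ F.≟ j ⌋ else 0)
                   ≡ (if ⌊ j′ F.≟ j ⌋ then 𝟙 (lookup (bxy (μ j′)) (f h)) else 0)
    single j = [ equal , apart ]′ (toSum (j′ F.≟ j))
      where
      c : Bool
      c = lookup (bxy (μ j)) (f h)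
      equal : j′ ≡ j → (if c then 𝟙 ⌊ j′ F.≟ j ⌋ else 0) ≡ (if ⌊ j′ F.≟ j ⌋ then 𝟙 (lookup (bxy (μ j′)) (f h)) else 0)
      equal refl = trans (cong (λ d → if c then 𝟙 d else 0) (⌊≟⌋-refl j′)) (sym (if-true (⌊≟⌋-refl j′)))
      apart : j′ ≢ j → (if c then 𝟙 ⌊ j′ F.≟ j ⌋ else 0) ≡ (if ⌊ j′ F.≟ j ⌋ then 𝟙 (lookup (bxy (μ j′)) (f h)) else 0)
      apart j′≢j = trans (cong (λ d → if c then 𝟙 d else 0) (≢⇒⌊≟⌋≡false j′≢j))
                            (trans (if-0 c) (sym (if-false (≢⇒⌊≟⌋≡false j′≢j))))

  𝔄⊨counting : ∀ h a → count n (λ b → Structure.B 𝔄 (f h) a b ∧ not ⌊ a F.≟ b ⌋) ≡ C h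
  𝔄⊨counting h a = begin
    count n (λ b → Structure.B 𝔄 (f h) a b ∧ not ⌊ a F.≟ b ⌋)        ≡⟨ count-cong n (B-carries h a) ⟩
    ∑ n (λ b → 𝟙 (carries h (message a b)))                          ≡⟨ ∑-cong n (λ b → 𝟙-carries h (message a b)) ⟩
    ∑ n (λ b → ∑ M (λ j → via j (𝟙 (message a b is j))))             ≡⟨ ∑-comm n M (λ b j → via j (𝟙 (message a b is j))) ⟩
    ∑ M (λ j → ∑ n (λ b → via j (𝟙 (message a b is j))))             ≡⟨ ∑-cong M per-message ⟩
    ∑ M (λ j → via j (out a j))                                      ≡⟨ proj₂ (proj₂ (proj₂ models)) (starOf a) h ⟩
    C h                                                              ∎
    where
    open ≡-Reasoning
    via : Fin M → ℕ → ℕ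
    via j x = if lookup (bxy (μ j)) (f h) then x else 0
    per-message : ∀ j → ∑ n (λ b → via j (𝟙 (message a b is j))) ≡ via j (out a j)
    per-message j = bool-cases (lookup (bxy (μ j)) (f h))
      (λ fj → trans (∑-cong n (λ b → if-true {x = 𝟙 (message a b is j)} {y = 0} fj)) (trans (count-cong n (λ b → message-is a b j))
                                                        (trans (count-sendsVia a j) (sym (if-true fj)))))
      (λ ¬fj → trans (∑-zero n (λ b → if-false {x = 𝟙 (message a b is j)} ¬fj)) (sym (if-false ¬fj)))

  𝔄⊨φ* : ModelsPhi* 𝔄 α β m f C
  𝔄⊨φ* = 𝔄⊨α , 𝔄⊨β , 𝔄⊨counting

-- Copies of the star-types

expand : ∀ N (w : Fin N → ℕ) → Fin (∑ N w) → Fin N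
expand (suc N) w e = [ (λ _ → zero) , suc ∘ expand N (w ∘ suc) ]′ (splitAt (w zero) e)

∑-expand : ∀ N (w : Fin N → ℕ) (g : Fin N → ℕ) → ∑ (∑ N w) (g ∘ expand N w) ≡ ∑ N (λ k → w k * g k)
∑-expand zero    w g = refl
∑-expand (suc N) w g = begin
  ∑ (∑ (suc N) w) (g ∘ expand (suc N) w)                                          ≡⟨ ∑-splitAt (w zero) (∑ N (w ∘ suc)) _ ⟩
  ∑ (w zero) (λ x → g (pick (splitAt (w zero) (x ↑ˡ rest))))
    + ∑ rest (λ y → g (pick (splitAt (w zero) (w zero ↑ʳ y))))                    ≡⟨ cong₂ _+_ (∑-cong (w zero) (λ x → cong (g ∘ pick) (FP.splitAt-↑ˡ (w zero) x rest)))
                                                                                                 (∑-cong rest (λ y → cong (g ∘ pick) (FP.splitAt-↑ʳ (w zero) rest y))) ⟩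
  ∑ (w zero) (λ _ → g zero) + ∑ rest (g ∘ suc ∘ expand N (w ∘ suc))               ≡⟨ cong₂ _+_ (∑-const (w zero) (g zero)) (∑-expand N (w ∘ suc) (g ∘ suc)) ⟩
  w zero * g zero + ∑ N (λ k → w (suc k) * g (suc k))                             ∎
  where
  open ≡-Reasoning
  rest : ℕ
  rest = ∑ N (w ∘ suc)
  pick : Fin (w zero) ⊎ Fin rest → Fin (suc N)
  pick = [ (λ _ → zero) , suc ∘ expand N (w ∘ suc) ]′

∑-positive : ∀ N (w : Fin N → ℕ) → 1 ≤ N → (∀ k → 1 ≤ w k) → 1 ≤ ∑ N w
∑-positive (suc N) w _ w≥1 = ≤-trans (w≥1 zero) (m≤m+n _ _)

lemma43 : (nU nB m : ℕ) (f : Fin m → Fin nB) (C : Fin m → ℕ)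
          (α : Fm nU nB 1) (β : Fm nU nB 2) →
          1 ≤ m → (∀ h → 1 ≤ C h) →
          (𝓕 : Ctx.Frame nU nB m f) → 1 ≤ Ctx.Frame.N 𝓕 →
          Ctx.IsChromatic nU nB m f 𝓕 →
          (Z : ℕ) → 1 ≤ Z → 3 * m * maxFin m C ∸ 1 ≤ Z →
          Σ (Fin (Ctx.Frame.N 𝓕) → ℕ) (Ctx.IsSolution nU nB m f 𝓕 Z) →
          Ctx.FrameModels nU nB m f 𝓕 α β C →
          Σ (Structure nU nB) (λ 𝔄 → ModelsPhi* 𝔄 α β m f C)
lemma43 nU nB m f C α β _ _ 𝓕 N≥1 chromatic Z _ Z-large (w , solution) models =
  onDomain (∑ N w) (∑-positive N w N≥1 (proj₁ solution)) (expand N w) (∑-expand N w)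
  where
  N : ℕ
  N = Ctx.Frame.N 𝓕
  onDomain : ∀ d → 1 ≤ d → (starOf : Fin d → Fin N) → (∀ g → ∑ d (g ∘ starOf) ≡ ∑ N (λ k → w k * g k)) →
             Σ (Structure nU nB) (λ 𝔄 → ModelsPhi* 𝔄 α β m f C)
  onDomain (suc size) _ starOf starOf-sum = 𝔄 , 𝔄⊨φ*
    where open Construction {C = C} {α} {β} 𝓕 chromatic Z-large solution models size starOf starOf-sum
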